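{- For every sequent $\Gamma \Rightarrow \delta$ of first-order arithmetic: if $\mathrm{CHA} \vdash \Gamma \Rightarrow \delta$ then $\mathrm{HA} \vdash \Gamma \Rightarrow \delta$.
   Context: Language: terms are built from variables, $0$, $S$, $+$, $\cdot$; formulas from $s=t$, $\bot$, $\wedge,\vee,\to,\forall,\exists$; $\neg\varphi:=\varphi\to\bot$, $\top:=\bot\to\bot$; $\varphi[t/x]$ is capture-avoiding substitution. A sequent $\Gamma\Rightarrow\delta$ consists of a finite set $\Gamma$ of formulas and a single formula $\delta$. $\mathrm{HA}$ (Heyting arithmetic) is the sequent calculus whose proofs are finite trees built from: the intuitionistic rules Ax ($\Gamma,\delta\Rightarrow\delta$), $\to$L, $\to$R, $\wedge$L, $\wedge$R, $\vee$L, $\vee$R, $\forall$L, $\forall$R and $\exists$L (with the usual eigenvariable conditions), $\exists$R, $\bot$L ($\Gamma,\bot\Rightarrow\delta$), $=$L (from $\Gamma[x/y]\Rightarrow\delta[x/y]$ infer $\Gamma[s/x,t/y], s=t\Rightarrow\delta[s/x,t/y]$, where $x,y\notin \mathrm{FV}(s,t)$), $=$R ($\Gamma\Rightarrow t=t$), weakening (from $\Gamma\Rightarrow\delta$ infer $\Gamma,\Gamma'\Rightarrow\delta$), cut (from $\Gamma\Rightarrow\varphi$ and $\Gamma,\varphi\Rightarrow\delta$ infer $\Gamma\Rightarrow\delta$); the arithmetic axioms $\Rightarrow 0\neq St$, $Ss=St\Rightarrow s=t$, $\Rightarrow s+0=s$, $\Rightarrow s+St=S(s+t)$, $\Rightarrow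 s\cdot 0=0$, $\Rightarrow s\cdot St=(s\cdot t)+s$; and the induction axioms $\varphi(0), \forall x.\,\varphi(x)\to\varphi(Sx)\Rightarrow\varphi(s)$ for every formula $\varphi$ and term $s$. $\mathrm{CHA}$ (cyclic Heyting arithmetic): its rules are those of $\mathrm{HA}$ without the induction axioms, plus the rule $\textsc{Case}_x$: from $\Gamma[0/x]\Rightarrow\delta[0/x]$ and $\Gamma[Sx/x]\Rightarrow\delta[Sx/x]$ infer $\Gamma\Rightarrow\delta$. A cyclic tree is a pair $(T,\beta)$ of a finite tree $T$ and a partial map $\beta$ from leaves of $T$ to inner nodes of $T$; leaves in $\mathrm{dom}(\beta)$ are buds and $\beta(t)$ is the companion of $t$. A pre-proof is a cyclic tree together with an assignment of rule instances to all non-bud nodes such that the children of a node are labelled by the premises of its rule, and each bud is labelled with the same sequent as its companion. An infinite branch is an infinite sequence of nodes starting at the root in which each next node is either a child of the current node or, if the current node is a bud, its companion. A variable $x$ has a trace along an infinite branch if from some point on $x$ is free in every sequent of the branch; the trace is progressing if the branch passes through instances of $\textsc{Case}_x$ infinitely often. A pre-proof is a $\mathrm{CHA}$-proof if along every infinite branch some variable has a progressing trace. $\mathrm{CHA}\vdash\Gamma\Rightarrow\delta$ means there is a $\mathrm{CHA}$-proof whose root is labelled $\Gamma\Rightarrow\delta$. -}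

module Defs where

open import Data.Nat using (ℕ; zero; suc; _≤_; _≟_)
open import Data.Fin using (Fin) renaming (zero to fz; suc to fs)
open import Data.List using (List; []; _∷_; _++_; [_]; map; concatMap)
open import Data.List.Membership.Propositional using (_∈_; _∉_)
open import Data.List.Relation.Binary.Subset.Propositional using (_⊆_)
open import Data.List.Relation.Unary.All using (All)
open import Data.List.Relation.Binary.Pointwise using (Pointwise)
open import Data.Maybe using (Maybe; just; nothing; Is-just)
open import Data.Product using (Σ; _×_; _,_)
open import Data.Sum using (_⊎_)
open import Data.Empty using (⊥)
open import Relation.Nullary using (¬_; yes; no)
open import Relation.Binary.PropositionalEquality using (_≡_)

-- Syntax of first-order arithmetic (locally nameless):
-- free variables are named by natural numbers (fv x), bound variables
-- are well-scoped de Bruijn indices (bv i : Fin n).  Thus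
-- alpha-equivalent formulas are syntactically equal and substitution
-- for free variables is automatically capture-avoiding.

data Term (n : ℕ) : Set where
  bv   : Fin n → Term n
  fv   : ℕ → Term n
  zer  : Term n
  succ : Term n → Term n
  _+ₜ_ : Term n → Term n → Term n
  _·ₜ_ : Term n → Term n → Term n

infix  4 _≐_
infixr 3 _∧ᶠ_
infixr 2 _∨ᶠ_
infixr 1 _⇒ᶠ_

data Formula (n : ℕ) : Set where
  _≐_  : Term n → Term n → Formula n
  ⊥ᶠ   : Formula n
  _∧ᶠ_ : Formula n → Formula n → Formula n
  _∨ᶠ_ : Formula n → Formula n → Formula n
  _⇒ᶠ_ : Formula n → Formula n → Formula n
  ∀ᶠ   : Formula (suc n) → Formula n   -- binds bv fz
  ∃ᶠ   : Formula (suc n) → Formula n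

¬ᶠ_ : ∀ {n} → Formula n → Formula n
¬ᶠ φ = φ ⇒ᶠ ⊥ᶠ

⊤ᶠ : ∀ {n} → Formula n
⊤ᶠ = ⊥ᶠ ⇒ᶠ ⊥ᶠ

liftR : ∀ {n m} → (Fin n → Fin m) → Fin (suc n) → Fin (suc m)
liftR ρ fz     = fz
liftR ρ (fs i) = fs (ρ i)

renT : ∀ {n m} → (Fin n → Fin m) → Term n → Term m
renT ρ (bv i)   = bv (ρ i)
renT ρ (fv x)   = fv x
renT ρ zer      = zer
renT ρ (succ t) = succ (renT ρ t)
renT ρ (s +ₜ t) = renT ρ s +ₜ renT ρ t
renT ρ (s ·ₜ t) = renT ρ s ·ₜ renT ρ t

wkT : ∀ {n} → Term n → Term (suc n)
wkT = renT fs

liftS : ∀ {n m} → (Fin n → Term m) → Fin (suc n) → Term (suc m)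
liftS σ fz     = bv fz
liftS σ (fs i) = wkT (σ i)

substT : ∀ {n m} → (Fin n → Term m) → Term n → Term m
substT σ (bv i)   = σ i
substT σ (fv x)   = fv x
substT σ zer      = zer
substT σ (succ t) = succ (substT σ t)
substT σ (s +ₜ t) = substT σ s +ₜ substT σ t
substT σ (s ·ₜ t) = substT σ s ·ₜ substT σ t

substF : ∀ {n m} → (Fin n → Term m) → Formula n → Formula m
substF σ (s ≐ t)   = substT σ s ≐ substT σ t
substF σ ⊥ᶠ        = ⊥ᶠ
substF σ (φ ∧ᶠ ψ)  = substF σ φ ∧ᶠ substF σ ψ
substF σ (φ ∨ᶠ ψ)  = substF σ φ ∨ᶠ substF σ ψ
substF σ (φ ⇒ᶠ ψ)  = substF σ φ ⇒ᶠ substF σ ψ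
substF σ (∀ᶠ φ)    = ∀ᶠ (substF (liftS σ) φ)
substF σ (∃ᶠ φ)    = ∃ᶠ (substF (liftS σ) φ)

-- instantiating the outermost bound variable: for Q ∈ {∀,∃},
-- (Q x. φ) with body φ, inst φ t is φ[t/x].
inst : Formula 1 → Term 0 → Formula 0
inst φ t = substF (λ _ → t) φ

-- the body φ(Sx) of the induction step, under the binder of x
stepBody : Formula 1 → Formula 1
stepBody φ = substF (λ _ → succ (bv fz)) φ

embed : ∀ {n} → Term 0 → Term n
embed = substT (λ ())

fsubT : ∀ {n} → (ℕ → Term 0) → Term n → Term n
fsubT σ (bv i)   = bv i
fsubT σ (fv x)   = embed (σ x)
fsubT σ zer      = zer
fsubT σ (succ t) = succ (fsubT σ t)
fsubT σ (s +ₜ t) = fsubT σ s +ₜ fsubT σ t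
fsubT σ (s ·ₜ t) = fsubT σ s ·ₜ fsubT σ t

fsubF : ∀ {n} → (ℕ → Term 0) → Formula n → Formula n
fsubF σ (s ≐ t)   = fsubT σ s ≐ fsubT σ t
fsubF σ ⊥ᶠ        = ⊥ᶠ
fsubF σ (φ ∧ᶠ ψ)  = fsubF σ φ ∧ᶠ fsubF σ ψ
fsubF σ (φ ∨ᶠ ψ)  = fsubF σ φ ∨ᶠ fsubF σ ψ
fsubF σ (φ ⇒ᶠ ψ)  = fsubF σ φ ⇒ᶠ fsubF σ ψ
fsubF σ (∀ᶠ φ)    = ∀ᶠ (fsubF σ φ)
fsubF σ (∃ᶠ φ)    = ∃ᶠ (fsubF σ φ)

single : ℕ → Term 0 → ℕ → Term 0
single x t y with y ≟ x
... | yes _ = t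
... | no  _ = fv y

double : ℕ → Term 0 → ℕ → Term 0 → ℕ → Term 0
double x s y t z with z ≟ x
... | yes _ = s
... | no  _ with z ≟ y
...   | yes _ = t
...   | no  _ = fv z

fvT : ∀ {n} → Term n → List ℕ
fvT (bv i)   = []
fvT (fv x)   = [ x ]
fvT zer      = []
fvT (succ t) = fvT t
fvT (s +ₜ t) = fvT s ++ fvT t
fvT (s ·ₜ t) = fvT s ++ fvT t

fvF : ∀ {n} → Formula n → List ℕ
fvF (s ≐ t)  = fvT s ++ fvT t
fvF ⊥ᶠ       = []
fvF (φ ∧ᶠ ψ) = fvF φ ++ fvF ψ
fvF (φ ∨ᶠ ψ) = fvF φ ++ fvF ψ
fvF (φ ⇒ᶠ ψ) = fvF φ ++ fvF ψ
fvF (∀ᶠ φ)   = fvF φ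
fvF (∃ᶠ φ)   = fvF φ

fvL : List (Formula 0) → List ℕ
fvL = concatMap fvF

-- Sequents: a finite set Γ (represented by a list, compared as a set)
-- and a single formula δ.

infix 0 _⟹_
record Sequent : Set where
  constructor _⟹_
  field
    ante : List (Formula 0)
    cons : Formula 0
open Sequent public

fvSeq : Sequent → List ℕ
fvSeq (Γ ⟹ δ) = fvL Γ ++ fvF δ

_≈ₛ_ : Sequent → Sequent → Set
(Γ ⟹ δ) ≈ₛ (Γ' ⟹ δ') = (Γ ⊆ Γ') × (Γ' ⊆ Γ) × (δ ≡ δ')

substSeq : (ℕ → Term 0) → Sequent → Sequent
substSeq σ (Γ ⟹ δ) = map (fsubF σ) Γ ⟹ fsubF σ δ

-- Rules common to HA and CHA: BaseRule C Ps means that there is a rule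
-- instance with conclusion C and list of premises Ps.

data BaseRule : Sequent → List Sequent → Set where
  ax   : ∀ Γ δ → BaseRule ((δ ∷ Γ) ⟹ δ) []
  ⇒L   : ∀ Γ φ ψ δ → BaseRule (((φ ⇒ᶠ ψ) ∷ Γ) ⟹ δ)
                         ((Γ ⟹ φ) ∷ ((ψ ∷ Γ) ⟹ δ) ∷ [])
  ⇒R   : ∀ Γ φ ψ → BaseRule (Γ ⟹ (φ ⇒ᶠ ψ)) [ (φ ∷ Γ) ⟹ ψ ]
  ∧L   : ∀ Γ φ ψ δ → BaseRule (((φ ∧ᶠ ψ) ∷ Γ) ⟹ δ) [ (φ ∷ ψ ∷ Γ) ⟹ δ ]
  ∧R   : ∀ Γ φ ψ → BaseRule (Γ ⟹ (φ ∧ᶠ ψ)) ((Γ ⟹ φ) ∷ (Γ ⟹ ψ) ∷ [])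
  ∨L   : ∀ Γ φ ψ δ → BaseRule (((φ ∨ᶠ ψ) ∷ Γ) ⟹ δ)
                         (((φ ∷ Γ) ⟹ δ) ∷ ((ψ ∷ Γ) ⟹ δ) ∷ [])
  ∨R₁  : ∀ Γ φ ψ → BaseRule (Γ ⟹ (φ ∨ᶠ ψ)) [ Γ ⟹ φ ]
  ∨R₂  : ∀ Γ φ ψ → BaseRule (Γ ⟹ (φ ∨ᶠ ψ)) [ Γ ⟹ ψ ]
  ∀L   : ∀ Γ φ (t : Term 0) δ → BaseRule ((∀ᶠ φ ∷ Γ) ⟹ δ) [ (inst φ t ∷ Γ) ⟹ δ ]
  ∀R   : ∀ Γ φ y → y ∉ fvL Γ → y ∉ fvF (∀ᶠ φ) →
         BaseRule (Γ ⟹ ∀ᶠ φ) [ Γ ⟹ inst φ (fv y) ]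
  ∃L   : ∀ Γ φ δ y → y ∉ fvL Γ → y ∉ fvF (∃ᶠ φ) → y ∉ fvF δ →
         BaseRule ((∃ᶠ φ ∷ Γ) ⟹ δ) [ (inst φ (fv y) ∷ Γ) ⟹ δ ]
  ∃R   : ∀ Γ φ (t : Term 0) → BaseRule (Γ ⟹ ∃ᶠ φ) [ Γ ⟹ inst φ t ]
  ⊥L   : ∀ Γ δ → BaseRule ((⊥ᶠ ∷ Γ) ⟹ δ) []
  ≐L   : ∀ Γ δ x y (s t : Term 0) → ¬ (x ≡ y) →
         x ∉ fvT s ++ fvT t → y ∉ fvT s ++ fvT t →
         BaseRule (((s ≐ t) ∷ map (fsubF (double x s y t)) Γ) ⟹ fsubF (double x s y t) δ)
                  [ map (fsubF (single y (fv x))) Γ ⟹ fsubF (single y (fv x)) δ ]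
  ≐R   : ∀ Γ (t : Term 0) → BaseRule (Γ ⟹ (t ≐ t)) []
  wk   : ∀ Γ Γ' δ → BaseRule ((Γ ++ Γ') ⟹ δ) [ Γ ⟹ δ ]
  cut  : ∀ Γ φ δ → BaseRule (Γ ⟹ δ) ((Γ ⟹ φ) ∷ ((φ ∷ Γ) ⟹ δ) ∷ [])
  zeroNeqS : ∀ (t : Term 0) → BaseRule ([] ⟹ ¬ᶠ (zer ≐ succ t)) []
  sInj     : ∀ (s t : Term 0) → BaseRule ([ succ s ≐ succ t ] ⟹ (s ≐ t)) []
  plus0    : ∀ (s : Term 0) → BaseRule ([] ⟹ ((s +ₜ zer) ≐ s)) []
  plusS    : ∀ (s t : Term 0) → BaseRule ([] ⟹ ((s +ₜ succ t) ≐ succ (s +ₜ t))) []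
  times0   : ∀ (s : Term 0) → BaseRule ([] ⟹ ((s ·ₜ zer) ≐ zer)) []
  timesS   : ∀ (s t : Term 0) → BaseRule ([] ⟹ ((s ·ₜ succ t) ≐ ((s ·ₜ t) +ₜ s))) []

-- HA: base rules plus induction axioms
--   φ(0), ∀x. φ(x) → φ(Sx) ⇒ φ(s)
-- where φ(x) is represented by its body φ : Formula 1.

data HARule : Sequent → List Sequent → Set where
  base : ∀ {C Ps} → BaseRule C Ps → HARule C Ps
  ind  : ∀ (φ : Formula 1) (s : Term 0) →
         HARule ((inst φ zer ∷ ∀ᶠ (φ ⇒ᶠ stepBody φ) ∷ []) ⟹ inst φ s) []

data HA⊢_ : Sequent → Set where
  by : ∀ {S C Ps} → HARule C Ps → S ≈ₛ C → All HA⊢_ Ps → HA⊢ S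

data CHARule : Sequent → List Sequent → Set where
  base : ∀ {C Ps} → BaseRule C Ps → CHARule C Ps
  case : ∀ (x : ℕ) Γ δ →
         CHARule (Γ ⟹ δ)
                 (substSeq (single x zer) (Γ ⟹ δ) ∷
                  substSeq (single x (succ (fv x))) (Γ ⟹ δ) ∷ [])

IsCase : ∀ {C Ps} → ℕ → CHARule C Ps → Set
IsCase x (base _)       = ⊥
IsCase x (case y _ _)   = x ≡ y

-- Cyclic trees.  A node is either a bud (a leaf labelled with a
-- sequent and the address of its companion) or a node labelled with a
-- sequent and a rule instance, with a list of children.
Path : Set
Path = List ℕ   -- child indices from the root

data PTree : Set where
  bud  : Sequent → Path → PTree
  node : (S : Sequent) (C : Sequent) (Ps : List Sequent) →
         CHARule C Ps → List PTree → PTree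

label : PTree → Sequent
label (bud S _)          = S
label (node S _ _ _ _)   = S

mutual
  subtree : PTree → Path → Maybe PTree
  subtree t               []      = just t
  subtree (bud _ _)       (_ ∷ _) = nothing
  subtree (node _ _ _ _ cs) (j ∷ p) = subtreeL cs j p

  subtreeL : List PTree → ℕ → Path → Maybe PTree
  subtreeL []       _       _ = nothing
  subtreeL (c ∷ cs) zero    p = subtree c p
  subtreeL (c ∷ cs) (suc j) p = subtreeL cs j p

NodesOK : PTree → Set
NodesOK t = ∀ p S C Ps (r : CHARule C Ps) cs →
  subtree t p ≡ just (node S C Ps r cs) →
  (S ≈ₛ C) × Pointwise (λ c P → label c ≈ₛ P) cs Ps

-- companion of a bud: an inner node (a node with at least one child)
-- labelled with the same sequent
BudsOK : PTree → Set
BudsOK t = ∀ p S q → subtree t p ≡ just (bud S q) →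
  Σ Sequent λ S₂ → Σ Sequent λ C → Σ (List Sequent) λ Ps →
  Σ (CHARule C Ps) λ r → Σ PTree λ c → Σ (List PTree) λ cs →
    (subtree t q ≡ just (node S₂ C Ps r (c ∷ cs))) × (S ≈ₛ S₂)

PreProof : PTree → Set
PreProof t = NodesOK t × BudsOK t

-- one step along a branch: to a child, or from a bud to its companion
Next : PTree → Path → Path → Set
Next t p p' =
  (Σ ℕ λ j → (p' ≡ p ++ [ j ]) × Is-just (subtree t p'))
  ⊎ (Σ Sequent λ S → subtree t p ≡ just (bud S p'))

InfiniteBranch : PTree → (ℕ → Path) → Set
InfiniteBranch t b = (b 0 ≡ []) × (∀ i → Next t (b i) (b (suc i)))

FreeInM : ℕ → Maybe PTree → Set
FreeInM x (just T) = x ∈ fvSeq (label T)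
FreeInM x nothing  = ⊥

CaseM : ℕ → Maybe PTree → Set
CaseM x (just (node _ _ _ r _)) = IsCase x r
CaseM x _                       = ⊥

ProgressingTrace : PTree → (ℕ → Path) → ℕ → Set
ProgressingTrace t b x =
  (Σ ℕ λ N → ∀ i → N ≤ i → FreeInM x (subtree t (b i)))
  × (∀ M → Σ ℕ λ i → (M ≤ i) × CaseM x (subtree t (b i)))

CHAProof : PTree → Set
CHAProof t = PreProof t ×
  (∀ b → InfiniteBranch t b → Σ ℕ λ x → ProgressingTrace t b x)

CHA⊢_ : Sequent → Set
CHA⊢ S = Σ PTree λ t → CHAProof t × (label t ≈ₛ S)

-- The inner nodes of a CHA pre-proof, with every bud identified with its
-- companion, form a finite graph.  By induction on the size of a set S of
-- such nodes we show that each node of S is provable in HA, possibly with an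
-- extra context H, once every edge leaving S ends at a node already proved.
-- If some node reaches only part of S, that part and the rest are smaller
-- and are handled in turn.  If S is strongly connected, an infinite branch
-- running around all of S infinitely often carries a progressing trace: a
-- variable x free throughout S and case-split at some node of S.  Then HA
-- proves by induction on x the conjunction ψ of the universal closures (in
-- all variables but x and those of H) of the sequents at the Case_x nodes of
-- S.  Its zero case comes from the zero premises, which lie outside S since x
-- is not free in them; in its step case, ψ makes the Case_x nodes axioms, and
-- the remaining nodes form a smaller set.

module Submission where

open import Defs

open import Data.Empty using (⊥-elim)
open import Data.Fin using (Fin; fromℕ; inject₁) renaming (zero to fz; suc to fs)
open import Data.List using (List; []; _∷_; _++_; [_]; map; length; filter)
open import Data.List.Membership.Propositional using (_∈_; _∉_; find; lose)
open import Data.List.Membership.Propositional.Properties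
  using (∈-++⁺ˡ; ∈-++⁺ʳ; ∈-++⁻; ∈-map⁺; ∈-map⁻; ∈-concat⁺′; ∈-concat⁻′; ∈-filter⁺; ∈-filter⁻)
open import Data.List.Properties
  using (concatMap-++; map-++; map-id-local; ++-assoc; ++-identityʳ; ≡-dec; filter-notAll)
open import Data.List.Relation.Binary.Permutation.Propositional using (↭-sym)
open import Data.List.Relation.Binary.Permutation.Propositional.Properties using (shift)
open import Data.List.Relation.Binary.Pointwise using (Pointwise; []; _∷_)
open import Data.List.Relation.Binary.Subset.Propositional using (_⊆_)
open import Data.List.Relation.Binary.Subset.Propositional.Properties
  using (⊆-refl; ⊆-trans; ⊆-reflexive-↭; ++⁺; ++⁺ʳ; ++⁺ˡ; ∷⁺ʳ; ∈-∷⁺ʳ; xs⊆x∷xs; xs⊆xs++ys; xs⊆ys++xs;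
         concatMap⁺; map⁺; Any-resp-⊆)
open import Data.List.Relation.Unary.All using (All; []; _∷_; tabulate; all?)
import Data.List.Relation.Unary.All as All
open import Data.List.Relation.Unary.All.Properties using (¬All⇒Any¬)
open import Data.List.Relation.Unary.Any using (Any; here; there; any?)
import Data.List.Relation.Unary.Any.Properties as Any
open import Data.Maybe using (Maybe; just; nothing; maybe′; _>>=_; Is-just)
open import Data.Maybe.Relation.Unary.Any using (just)
open import Data.Nat using (ℕ; zero; suc; _+_; _≤_; _<_; z≤n; s≤s; _≟_)
open import Data.Nat.Properties using (+-identityʳ; +-suc; ≤-trans; ≤-refl; ≤-pred; <-≤-trans; m≤n+m; n≤1+n)
open import Data.Product using (Σ; ∃; ∃₂; _×_; _,_; proj₁; proj₂)
open import Data.Sum using (_⊎_; inj₁; inj₂; [_,_]′)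
open import Data.Unit using (tt)
open import Function using (_∘_; id; case_of_)
open import Relation.Binary.Definitions using (DecidableEquality)
open import Relation.Binary.PropositionalEquality hiding ([_])
open import Relation.Nullary using (¬_; Dec; yes; no)
open import Relation.Nullary.Decidable using (_⊎-dec_; _×-dec_; ¬?; decidable-stable)
open import Relation.Unary using (Decidable)

open import Data.List.Membership.DecPropositional _≟_ using () renaming (_∈?_ to _∈ℕ?_)

renT-embed : ∀ {n m} (ρ : Fin n → Fin m) (u : Term 0) → renT ρ (embed u) ≡ embed u
renT-embed ρ (bv ())
renT-embed ρ (fv x)   = refl
renT-embed ρ zer      = refl
renT-embed ρ (succ u) = cong succ (renT-embed ρ u)
renT-embed ρ (s +ₜ t) = cong₂ _+ₜ_ (renT-embed ρ s) (renT-embed ρ t)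
renT-embed ρ (s ·ₜ t) = cong₂ _·ₜ_ (renT-embed ρ s) (renT-embed ρ t)

embed-id : (u : Term 0) → embed u ≡ u
embed-id (bv ())
embed-id (fv x)   = refl
embed-id zer      = refl
embed-id (succ u) = cong succ (embed-id u)
embed-id (s +ₜ t) = cong₂ _+ₜ_ (embed-id s) (embed-id t)
embed-id (s ·ₜ t) = cong₂ _·ₜ_ (embed-id s) (embed-id t)

substT-wkT : ∀ {n m} (σ : Fin n → Term m) (u : Term n) →
  substT (liftS σ) (wkT u) ≡ wkT (substT σ u)
substT-wkT σ (bv i)   = refl
substT-wkT σ (fv x)   = refl
substT-wkT σ zer      = refl
substT-wkT σ (succ u) = cong succ (substT-wkT σ u)
substT-wkT σ (s +ₜ t) = cong₂ _+ₜ_ (substT-wkT σ s) (substT-wkT σ t)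
substT-wkT σ (s ·ₜ t) = cong₂ _·ₜ_ (substT-wkT σ s) (substT-wkT σ t)

substT-∘ : ∀ {n m k} (σ : Fin m → Term k) (τ : Fin n → Term m) (ρ : Fin n → Term k) →
  (∀ i → substT σ (τ i) ≡ ρ i) → ∀ t → substT σ (substT τ t) ≡ substT ρ t
substT-∘ σ τ ρ h (bv i)   = h i
substT-∘ σ τ ρ h (fv x)   = refl
substT-∘ σ τ ρ h zer      = refl
substT-∘ σ τ ρ h (succ t) = cong succ (substT-∘ σ τ ρ h t)
substT-∘ σ τ ρ h (s +ₜ t) = cong₂ _+ₜ_ (substT-∘ σ τ ρ h s) (substT-∘ σ τ ρ h t)
substT-∘ σ τ ρ h (s ·ₜ t) = cong₂ _·ₜ_ (substT-∘ σ τ ρ h s) (substT-∘ σ τ ρ h t)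

liftS-∘ : ∀ {n m k} (σ : Fin m → Term k) (τ : Fin n → Term m) (ρ : Fin n → Term k) →
  (∀ i → substT σ (τ i) ≡ ρ i) → ∀ i → substT (liftS σ) (liftS τ i) ≡ liftS ρ i
liftS-∘ σ τ ρ h fz     = refl
liftS-∘ σ τ ρ h (fs i) = trans (substT-wkT σ (τ i)) (cong wkT (h i))

substF-∘ : ∀ {n m k} (σ : Fin m → Term k) (τ : Fin n → Term m) (ρ : Fin n → Term k) →
  (∀ i → substT σ (τ i) ≡ ρ i) → ∀ φ → substF σ (substF τ φ) ≡ substF ρ φ
substF-∘ σ τ ρ h (s ≐ t)  = cong₂ _≐_ (substT-∘ σ τ ρ h s) (substT-∘ σ τ ρ h t)
substF-∘ σ τ ρ h ⊥ᶠ       = refl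
substF-∘ σ τ ρ h (φ ∧ᶠ ψ) = cong₂ _∧ᶠ_ (substF-∘ σ τ ρ h φ) (substF-∘ σ τ ρ h ψ)
substF-∘ σ τ ρ h (φ ∨ᶠ ψ) = cong₂ _∨ᶠ_ (substF-∘ σ τ ρ h φ) (substF-∘ σ τ ρ h ψ)
substF-∘ σ τ ρ h (φ ⇒ᶠ ψ) = cong₂ _⇒ᶠ_ (substF-∘ σ τ ρ h φ) (substF-∘ σ τ ρ h ψ)
substF-∘ σ τ ρ h (∀ᶠ φ)   = cong ∀ᶠ (substF-∘ (liftS σ) (liftS τ) (liftS ρ) (liftS-∘ σ τ ρ h) φ)
substF-∘ σ τ ρ h (∃ᶠ φ)   = cong ∃ᶠ (substF-∘ (liftS σ) (liftS τ) (liftS ρ) (liftS-∘ σ τ ρ h) φ)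

-- Under k binders the new binder is the outermost one, hence the index fromℕ k.
closeT : ∀ {k} → ℕ → Term k → Term (suc k)
closeT x (bv i)   = bv (inject₁ i)
closeT {k} x (fv y) with y ≟ x
... | yes _ = bv (fromℕ k)
... | no  _ = fv y
closeT x zer      = zer
closeT x (succ t) = succ (closeT x t)
closeT x (s +ₜ t) = closeT x s +ₜ closeT x t
closeT x (s ·ₜ t) = closeT x s ·ₜ closeT x t

closeF : ∀ {k} → ℕ → Formula k → Formula (suc k)
closeF x (s ≐ t)  = closeT x s ≐ closeT x t
closeF x ⊥ᶠ       = ⊥ᶠ
closeF x (φ ∧ᶠ ψ) = closeF x φ ∧ᶠ closeF x ψ
closeF x (φ ∨ᶠ ψ) = closeF x φ ∨ᶠ closeF x ψ
closeF x (φ ⇒ᶠ ψ) = closeF x φ ⇒ᶠ closeF x ψ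
closeF x (∀ᶠ φ)   = ∀ᶠ (closeF x φ)
closeF x (∃ᶠ φ)   = ∃ᶠ (closeF x φ)

record Opens {k} (σ : Fin (suc k) → Term k) (u : Term 0) : Set where
  field
    old : ∀ i → σ (inject₁ i) ≡ bv i
    new : σ (fromℕ k) ≡ embed u
open Opens

liftS-Opens : ∀ {k} {σ : Fin (suc k) → Term k} {u} → Opens σ u → Opens (liftS σ) u
liftS-Opens o .old fz     = refl
liftS-Opens o .old (fs i) = cong wkT (old o i)
liftS-Opens {u = u} o .new = trans (cong wkT (new o)) (renT-embed fs u)

substT-closeT : ∀ {k} {σ : Fin (suc k) → Term k} {u} → Opens σ u → ∀ x (t : Term k) →
  substT σ (closeT x t) ≡ fsubT (single x u) t
substT-closeT o x (bv i) = old o i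
substT-closeT o x (fv y) with y ≟ x
... | yes _ = new o
... | no  _ = refl
substT-closeT o x zer      = refl
substT-closeT o x (succ t) = cong succ (substT-closeT o x t)
substT-closeT o x (s +ₜ t) = cong₂ _+ₜ_ (substT-closeT o x s) (substT-closeT o x t)
substT-closeT o x (s ·ₜ t) = cong₂ _·ₜ_ (substT-closeT o x s) (substT-closeT o x t)

substF-closeF : ∀ {k} {σ : Fin (suc k) → Term k} {u} → Opens σ u → ∀ x (φ : Formula k) →
  substF σ (closeF x φ) ≡ fsubF (single x u) φ
substF-closeF o x (s ≐ t)  = cong₂ _≐_ (substT-closeT o x s) (substT-closeT o x t)
substF-closeF o x ⊥ᶠ       = refl
substF-closeF o x (φ ∧ᶠ ψ) = cong₂ _∧ᶠ_ (substF-closeF o x φ) (substF-closeF o x ψ)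
substF-closeF o x (φ ∨ᶠ ψ) = cong₂ _∨ᶠ_ (substF-closeF o x φ) (substF-closeF o x ψ)
substF-closeF o x (φ ⇒ᶠ ψ) = cong₂ _⇒ᶠ_ (substF-closeF o x φ) (substF-closeF o x ψ)
substF-closeF o x (∀ᶠ φ)   = cong ∀ᶠ (substF-closeF (liftS-Opens o) x φ)
substF-closeF o x (∃ᶠ φ)   = cong ∃ᶠ (substF-closeF (liftS-Opens o) x φ)

inst-closeF : ∀ x (φ : Formula 0) (t : Term 0) → inst (closeF x φ) t ≡ fsubF (single x t) φ
inst-closeF x φ t = substF-closeF opens x φ
  where
  opens : Opens (λ _ → t) t
  opens .old ()
  opens .new = sym (embed-id t)

inst-stepBody-closeF : ∀ x (φ : Formula 0) (t : Term 0) →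
  inst (stepBody (closeF x φ)) t ≡ fsubF (single x (succ t)) φ
inst-stepBody-closeF x φ t =
  trans (substF-∘ (λ _ → t) (λ _ → succ (bv fz)) (λ _ → succ t) (λ _ → refl) (closeF x φ))
        (inst-closeF x φ (succ t))

single-≢ : ∀ x t y → ¬ y ≡ x → single x t y ≡ fv y
single-≢ x t y y≢x with y ≟ x
... | yes y≡x = ⊥-elim (y≢x y≡x)
... | no  _   = refl

single-fv-self : ∀ x y → single x (fv x) y ≡ fv y
single-fv-self x y with y ≟ x
... | yes refl = refl
... | no  _    = refl

fsubT-id : ∀ {n} (σ : ℕ → Term 0) (t : Term n) → (∀ y → y ∈ fvT t → σ y ≡ fv y) → fsubT σ t ≡ t
fsubT-id σ (bv i)   h = refl
fsubT-id σ (fv x)   h = cong embed (h x (here refl))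
fsubT-id σ zer      h = refl
fsubT-id σ (succ t) h = cong succ (fsubT-id σ t h)
fsubT-id σ (s +ₜ t) h = cong₂ _+ₜ_ (fsubT-id σ s (λ y → h y ∘ ∈-++⁺ˡ)) (fsubT-id σ t (λ y → h y ∘ ∈-++⁺ʳ _))
fsubT-id σ (s ·ₜ t) h = cong₂ _·ₜ_ (fsubT-id σ s (λ y → h y ∘ ∈-++⁺ˡ)) (fsubT-id σ t (λ y → h y ∘ ∈-++⁺ʳ _))

fsubF-id : ∀ {n} (σ : ℕ → Term 0) (φ : Formula n) → (∀ y → y ∈ fvF φ → σ y ≡ fv y) → fsubF σ φ ≡ φ
fsubF-id σ (s ≐ t)  h = cong₂ _≐_ (fsubT-id σ s (λ y → h y ∘ ∈-++⁺ˡ)) (fsubT-id σ t (λ y → h y ∘ ∈-++⁺ʳ _))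
fsubF-id σ ⊥ᶠ       h = refl
fsubF-id σ (φ ∧ᶠ ψ) h = cong₂ _∧ᶠ_ (fsubF-id σ φ (λ y → h y ∘ ∈-++⁺ˡ)) (fsubF-id σ ψ (λ y → h y ∘ ∈-++⁺ʳ _))
fsubF-id σ (φ ∨ᶠ ψ) h = cong₂ _∨ᶠ_ (fsubF-id σ φ (λ y → h y ∘ ∈-++⁺ˡ)) (fsubF-id σ ψ (λ y → h y ∘ ∈-++⁺ʳ _))
fsubF-id σ (φ ⇒ᶠ ψ) h = cong₂ _⇒ᶠ_ (fsubF-id σ φ (λ y → h y ∘ ∈-++⁺ˡ)) (fsubF-id σ ψ (λ y → h y ∘ ∈-++⁺ʳ _))
fsubF-id σ (∀ᶠ φ)   h = cong ∀ᶠ (fsubF-id σ φ h)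
fsubF-id σ (∃ᶠ φ)   h = cong ∃ᶠ (fsubF-id σ φ h)

inst-closeF-fv : ∀ x (φ : Formula 0) → inst (closeF x φ) (fv x) ≡ φ
inst-closeF-fv x φ = trans (inst-closeF x φ (fv x)) (fsubF-id _ φ (λ y _ → single-fv-self x y))

fvT-embed : ∀ {n} (u : Term 0) → fvT (embed {n} u) ⊆ fvT u
fvT-embed (bv ())
fvT-embed (fv x)   = id
fvT-embed zer      = λ ()
fvT-embed (succ u) = fvT-embed u
fvT-embed (s +ₜ t) = ++⁺ (fvT-embed s) (fvT-embed t)
fvT-embed (s ·ₜ t) = ++⁺ (fvT-embed s) (fvT-embed t)

fvT-renT : ∀ {n m} (ρ : Fin n → Fin m) (t : Term n) → fvT (renT ρ t) ≡ fvT t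
fvT-renT ρ (bv i)   = refl
fvT-renT ρ (fv x)   = refl
fvT-renT ρ zer      = refl
fvT-renT ρ (succ t) = fvT-renT ρ t
fvT-renT ρ (s +ₜ t) = cong₂ _++_ (fvT-renT ρ s) (fvT-renT ρ t)
fvT-renT ρ (s ·ₜ t) = cong₂ _++_ (fvT-renT ρ s) (fvT-renT ρ t)

ClosedSubst : ∀ {n k} → (Fin n → Term k) → Set
ClosedSubst σ = ∀ i → fvT (σ i) ≡ []

liftS-ClosedSubst : ∀ {n k} {σ : Fin n → Term k} → ClosedSubst σ → ClosedSubst (liftS σ)
liftS-ClosedSubst c fz             = refl
liftS-ClosedSubst {σ = σ} c (fs i) = trans (fvT-renT fs (σ i)) (c i)

fvT-substT : ∀ {n k} {σ : Fin n → Term k} → ClosedSubst σ → ∀ t → fvT (substT σ t) ⊆ fvT t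
fvT-substT c (bv i) m with () ← subst (_ ∈_) (c i) m
fvT-substT c (fv x)   = id
fvT-substT c zer      = λ ()
fvT-substT c (succ t) = fvT-substT c t
fvT-substT c (s +ₜ t) = ++⁺ (fvT-substT c s) (fvT-substT c t)
fvT-substT c (s ·ₜ t) = ++⁺ (fvT-substT c s) (fvT-substT c t)

fvF-substF : ∀ {n k} {σ : Fin n → Term k} → ClosedSubst σ → ∀ φ → fvF (substF σ φ) ⊆ fvF φ
fvF-substF c (s ≐ t)  = ++⁺ (fvT-substT c s) (fvT-substT c t)
fvF-substF c ⊥ᶠ       = λ ()
fvF-substF c (φ ∧ᶠ ψ) = ++⁺ (fvF-substF c φ) (fvF-substF c ψ)
fvF-substF c (φ ∨ᶠ ψ) = ++⁺ (fvF-substF c φ) (fvF-substF c ψ)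
fvF-substF c (φ ⇒ᶠ ψ) = ++⁺ (fvF-substF c φ) (fvF-substF c ψ)
fvF-substF c (∀ᶠ φ)   = fvF-substF (liftS-ClosedSubst c) φ
fvF-substF c (∃ᶠ φ)   = fvF-substF (liftS-ClosedSubst c) φ

fvF-stepBody : (φ : Formula 1) → fvF (stepBody φ) ⊆ fvF φ
fvF-stepBody = fvF-substF (λ _ → refl)

Origin : (ℕ → Term 0) → List ℕ → ℕ → Set
Origin σ zs y = Any (λ z → y ∈ fvT (σ z)) zs

fvT-fsubT : ∀ {n} σ (t : Term n) {y} → y ∈ fvT (fsubT σ t) → Origin σ (fvT t) y
fvT-fsubT σ (bv i) ()
fvT-fsubT σ (fv x)   m = here (fvT-embed (σ x) m)
fvT-fsubT σ zer ()
fvT-fsubT σ (succ t) m = fvT-fsubT σ t m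
fvT-fsubT σ (s +ₜ t) m = [ Any.++⁺ˡ ∘ fvT-fsubT σ s , Any.++⁺ʳ _ ∘ fvT-fsubT σ t ]′ (∈-++⁻ _ m)
fvT-fsubT σ (s ·ₜ t) m = [ Any.++⁺ˡ ∘ fvT-fsubT σ s , Any.++⁺ʳ _ ∘ fvT-fsubT σ t ]′ (∈-++⁻ _ m)

fvF-fsubF : ∀ {n} σ (φ : Formula n) {y} → y ∈ fvF (fsubF σ φ) → Origin σ (fvF φ) y
fvF-fsubF σ (s ≐ t)  m = [ Any.++⁺ˡ ∘ fvT-fsubT σ s , Any.++⁺ʳ _ ∘ fvT-fsubT σ t ]′ (∈-++⁻ _ m)
fvF-fsubF σ ⊥ᶠ ()
fvF-fsubF σ (φ ∧ᶠ ψ) m = [ Any.++⁺ˡ ∘ fvF-fsubF σ φ , Any.++⁺ʳ _ ∘ fvF-fsubF σ ψ ]′ (∈-++⁻ _ m)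
fvF-fsubF σ (φ ∨ᶠ ψ) m = [ Any.++⁺ˡ ∘ fvF-fsubF σ φ , Any.++⁺ʳ _ ∘ fvF-fsubF σ ψ ]′ (∈-++⁻ _ m)
fvF-fsubF σ (φ ⇒ᶠ ψ) m = [ Any.++⁺ˡ ∘ fvF-fsubF σ φ , Any.++⁺ʳ _ ∘ fvF-fsubF σ ψ ]′ (∈-++⁻ _ m)
fvF-fsubF σ (∀ᶠ φ)   m = fvF-fsubF σ φ m
fvF-fsubF σ (∃ᶠ φ)   m = fvF-fsubF σ φ m

fvT-closeT : ∀ {k} x (t : Term k) → fvT (closeT x t) ⊆ fvT t
fvT-closeT x (bv i) ()
fvT-closeT x (fv y) m with y ≟ x
fvT-closeT x (fv y) () | yes _
fvT-closeT x (fv y) m  | no  _ = m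
fvT-closeT x zer ()
fvT-closeT x (succ t) = fvT-closeT x t
fvT-closeT x (s +ₜ t) = ++⁺ (fvT-closeT x s) (fvT-closeT x t)
fvT-closeT x (s ·ₜ t) = ++⁺ (fvT-closeT x s) (fvT-closeT x t)

fvF-closeF : ∀ {k} x (φ : Formula k) → fvF (closeF x φ) ⊆ fvF φ
fvF-closeF x (s ≐ t)  = ++⁺ (fvT-closeT x s) (fvT-closeT x t)
fvF-closeF x ⊥ᶠ       = λ ()
fvF-closeF x (φ ∧ᶠ ψ) = ++⁺ (fvF-closeF x φ) (fvF-closeF x ψ)
fvF-closeF x (φ ∨ᶠ ψ) = ++⁺ (fvF-closeF x φ) (fvF-closeF x ψ)
fvF-closeF x (φ ⇒ᶠ ψ) = ++⁺ (fvF-closeF x φ) (fvF-closeF x ψ)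
fvF-closeF x (∀ᶠ φ)   = fvF-closeF x φ
fvF-closeF x (∃ᶠ φ)   = fvF-closeF x φ

∉-fvT-closeT : ∀ {k} x (t : Term k) → x ∉ fvT (closeT x t)
∉-fvT-closeT x (bv i) ()
∉-fvT-closeT x (fv y) m with y ≟ x
∉-fvT-closeT x (fv y) ()         | yes _
∉-fvT-closeT x (fv y) (here x≡y) | no y≢x = y≢x (sym x≡y)
∉-fvT-closeT x zer ()
∉-fvT-closeT x (succ t) = ∉-fvT-closeT x t
∉-fvT-closeT x (s +ₜ t) = [ ∉-fvT-closeT x s , ∉-fvT-closeT x t ]′ ∘ ∈-++⁻ _
∉-fvT-closeT x (s ·ₜ t) = [ ∉-fvT-closeT x s , ∉-fvT-closeT x t ]′ ∘ ∈-++⁻ _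

∉-fvF-closeF : ∀ {k} x (φ : Formula k) → x ∉ fvF (closeF x φ)
∉-fvF-closeF x (s ≐ t)  = [ ∉-fvT-closeT x s , ∉-fvT-closeT x t ]′ ∘ ∈-++⁻ _
∉-fvF-closeF x ⊥ᶠ ()
∉-fvF-closeF x (φ ∧ᶠ ψ) = [ ∉-fvF-closeF x φ , ∉-fvF-closeF x ψ ]′ ∘ ∈-++⁻ _
∉-fvF-closeF x (φ ∨ᶠ ψ) = [ ∉-fvF-closeF x φ , ∉-fvF-closeF x ψ ]′ ∘ ∈-++⁻ _
∉-fvF-closeF x (φ ⇒ᶠ ψ) = [ ∉-fvF-closeF x φ , ∉-fvF-closeF x ψ ]′ ∘ ∈-++⁻ _
∉-fvF-closeF x (∀ᶠ φ)   = ∉-fvF-closeF x φ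
∉-fvF-closeF x (∃ᶠ φ)   = ∉-fvF-closeF x φ

record Fixes (σ : ℕ → Term 0) (z : ℕ) : Set where
  field
    fixed : σ z ≡ fv z
    fresh : ∀ y → ¬ y ≡ z → z ∉ fvT (σ y)
open Fixes

closeT-embed : ∀ {k} z (u : Term 0) → z ∉ fvT u → closeT {k} z (embed u) ≡ embed u
closeT-embed z (bv ())
closeT-embed z (fv w) z∉ with w ≟ z
... | yes refl = ⊥-elim (z∉ (here refl))
... | no  _    = refl
closeT-embed z zer      z∉ = refl
closeT-embed z (succ u) z∉ = cong succ (closeT-embed z u z∉)
closeT-embed z (s +ₜ t) z∉ = cong₂ _+ₜ_ (closeT-embed z s (z∉ ∘ ∈-++⁺ˡ)) (closeT-embed z t (z∉ ∘ ∈-++⁺ʳ _))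
closeT-embed z (s ·ₜ t) z∉ = cong₂ _·ₜ_ (closeT-embed z s (z∉ ∘ ∈-++⁺ˡ)) (closeT-embed z t (z∉ ∘ ∈-++⁺ʳ _))

fsubT-closeT : ∀ {k} {σ z} → Fixes σ z → (t : Term k) → fsubT σ (closeT z t) ≡ closeT z (fsubT σ t)
fsubT-closeT f (bv i) = refl
fsubT-closeT {σ = σ} {z} f (fv y) with y ≟ z
... | no y≢z = sym (closeT-embed z (σ y) (fresh f y y≢z))
... | yes refl rewrite fixed f with z ≟ z
...   | yes _   = refl
...   | no  z≢z = ⊥-elim (z≢z refl)
fsubT-closeT f zer      = refl
fsubT-closeT f (succ t) = cong succ (fsubT-closeT f t)
fsubT-closeT f (s +ₜ t) = cong₂ _+ₜ_ (fsubT-closeT f s) (fsubT-closeT f t)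
fsubT-closeT f (s ·ₜ t) = cong₂ _·ₜ_ (fsubT-closeT f s) (fsubT-closeT f t)

fsubF-closeF : ∀ {k} {σ z} → Fixes σ z → (φ : Formula k) → fsubF σ (closeF z φ) ≡ closeF z (fsubF σ φ)
fsubF-closeF f (s ≐ t)  = cong₂ _≐_ (fsubT-closeT f s) (fsubT-closeT f t)
fsubF-closeF f ⊥ᶠ       = refl
fsubF-closeF f (φ ∧ᶠ ψ) = cong₂ _∧ᶠ_ (fsubF-closeF f φ) (fsubF-closeF f ψ)
fsubF-closeF f (φ ∨ᶠ ψ) = cong₂ _∨ᶠ_ (fsubF-closeF f φ) (fsubF-closeF f ψ)
fsubF-closeF f (φ ⇒ᶠ ψ) = cong₂ _⇒ᶠ_ (fsubF-closeF f φ) (fsubF-closeF f ψ)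
fsubF-closeF f (∀ᶠ φ)   = cong ∀ᶠ (fsubF-closeF f φ)
fsubF-closeF f (∃ᶠ φ)   = cong ∃ᶠ (fsubF-closeF f φ)

fvT-single : ∀ x u y {z} → z ∈ fvT (single x u y) → (y ≡ x × z ∈ fvT u) ⊎ (¬ y ≡ x × z ≡ y)
fvT-single x u y z∈ with y ≟ x
... | yes y≡x = inj₁ (y≡x , z∈)
fvT-single x u y (here refl) | no y≢x = inj₂ (y≢x , refl)

single-Fixes : ∀ x u z → ¬ z ≡ x → z ∉ fvT u → Fixes (single x u) z
single-Fixes x u z z≢x z∉u .fixed = single-≢ x u z z≢x
single-Fixes x u z z≢x z∉u .fresh y y≢z z∈ with fvT-single x u y z∈
... | inj₁ (_ , z∈u) = z∉u z∈u
... | inj₂ (_ , z≡y) = y≢z (sym z≡y)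

pull : ∀ {A : Set} (xs : List A) {x ys zs} → ys ⊆ zs → xs ++ x ∷ ys ⊆ x ∷ xs ++ zs
pull xs ys⊆zs = ⊆-trans (++⁺ʳ xs (∷⁺ʳ _ ys⊆zs)) (⊆-reflexive-↭ (shift _ xs _))

push : ∀ {A : Set} (xs : List A) {x ys} → x ∷ xs ++ ys ⊆ xs ++ x ∷ ys
push xs = ⊆-reflexive-↭ (↭-sym (shift _ xs _))

∈⇒nonempty : ∀ {A : Set} {x : A} {xs} → x ∈ xs → ∃₂ λ y ys → xs ≡ y ∷ ys
∈⇒nonempty (here _)  = _ , _ , refl
∈⇒nonempty (there _) = _ , _ , refl

fvL-∈ : ∀ {Γ φ} → φ ∈ Γ → fvF φ ⊆ fvL Γ
fvL-∈ φ∈Γ y∈φ = ∈-concat⁺′ y∈φ (∈-map⁺ fvF φ∈Γ)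

fvL-∈⁻ : ∀ Γ {y} → y ∈ fvL Γ → ∃ λ φ → φ ∈ Γ × y ∈ fvF φ
fvL-∈⁻ Γ y∈Γ with _ , y∈xs , xs∈ ← ∈-concat⁻′ (map fvF Γ) y∈Γ with φ , φ∈Γ , refl ← ∈-map⁻ fvF xs∈ =
  φ , φ∈Γ , y∈xs

fvL-⊆ : ∀ {Γ Γ′} → Γ ⊆ Γ′ → fvL Γ ⊆ fvL Γ′
fvL-⊆ = concatMap⁺ fvF

fvL-++⁻ : ∀ Γ {Γ′ y} → y ∈ fvL (Γ ++ Γ′) → y ∈ fvL Γ ⊎ y ∈ fvL Γ′
fvL-++⁻ Γ {Γ′} y∈ = ∈-++⁻ (fvL Γ) (subst (_ ∈_) (concatMap-++ fvF Γ Γ′) y∈)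

fvL-map-fsubF : ∀ σ Γ {y} → y ∈ fvL (map (fsubF σ) Γ) → Origin σ (fvL Γ) y
fvL-map-fsubF σ Γ y∈ with φ′ , φ′∈ , y∈φ′ ← fvL-∈⁻ (map (fsubF σ) Γ) y∈
                       with φ , φ∈Γ , refl ← ∈-map⁻ (fsubF σ) φ′∈ =
  Any-resp-⊆ (fvL-∈ φ∈Γ) (fvF-fsubF σ φ y∈φ′)

≈ₛ-refl : ∀ {S} → S ≈ₛ S
≈ₛ-refl = ⊆-refl , ⊆-refl , refl

≈ₛ-sym : ∀ {S T} → S ≈ₛ T → T ≈ₛ S
≈ₛ-sym (⊆₁ , ⊆₂ , eq) = ⊆₂ , ⊆₁ , sym eq

≈ₛ-trans : ∀ {S T U} → S ≈ₛ T → T ≈ₛ U → S ≈ₛ U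
≈ₛ-trans (⊆₁ , ⊇₁ , eq₁) (⊆₂ , ⊇₂ , eq₂) = ⊆-trans ⊆₁ ⊆₂ , ⊆-trans ⊇₂ ⊇₁ , trans eq₁ eq₂

fvSeq-≈ : ∀ {S T} → S ≈ₛ T → fvSeq S ⊆ fvSeq T
fvSeq-≈ {_ ⟹ _} {_ ⟹ _} (Γ⊆ , _ , refl) = ++⁺ (fvL-⊆ Γ⊆) ⊆-refl

substSeq-≈ : ∀ σ {S T} → S ≈ₛ T → substSeq σ S ≈ₛ substSeq σ T
substSeq-≈ σ {_ ⟹ _} {_ ⟹ _} (Γ⊆ , Γ⊇ , refl) = map⁺ (fsubF σ) Γ⊆ , map⁺ (fsubF σ) Γ⊇ , refl

∉-fvSeq-single-zer : ∀ x S → x ∉ fvSeq (substSeq (single x zer) S)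
∉-fvSeq-single-zer x (Γ ⟹ δ) =
  [ no-origin ∘ fvL-map-fsubF (single x zer) Γ , no-origin ∘ fvF-fsubF (single x zer) δ ]′
  ∘ ∈-++⁻ (fvL (map (fsubF (single x zer)) Γ))
  where
  no-origin : ∀ {zs} → ¬ Origin (single x zer) zs x
  no-origin o with z , _ , x∈ ← find o with fvT-single x zer z x∈
  ... | inj₁ (_ , ())
  ... | inj₂ (z≢x , refl) = z≢x refl

by-base : ∀ {C Ps} → BaseRule C Ps → All HA⊢_ Ps → HA⊢ C
by-base r = by (base r) ≈ₛ-refl

-- Antecedents are sets, so φ ∷ Γ is Γ when φ ∈ Γ.
by-left : ∀ {φ Γ δ Ps} → φ ∈ Γ → BaseRule ((φ ∷ Γ) ⟹ δ) Ps → All HA⊢_ Ps → HA⊢ (Γ ⟹ δ)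
by-left φ∈Γ r = by (base r) (xs⊆x∷xs _ _ , ∈-∷⁺ʳ φ∈Γ ⊆-refl , refl)

HA-wk : ∀ {Γ Γ′ δ} → Γ ⊆ Γ′ → HA⊢ (Γ ⟹ δ) → HA⊢ (Γ′ ⟹ δ)
HA-wk {Γ} {Γ′} {δ} Γ⊆Γ′ p =
  by (base (wk Γ Γ′ δ)) (xs⊆ys++xs Γ′ Γ , [ Γ⊆Γ′ , id ]′ ∘ ∈-++⁻ Γ , refl) (p ∷ [])

HA-ax : ∀ {Γ δ} → δ ∈ Γ → HA⊢ (Γ ⟹ δ)
HA-ax δ∈Γ = by-left δ∈Γ (ax _ _) []

HA-⊥L : ∀ {Γ δ} → ⊥ᶠ ∈ Γ → HA⊢ (Γ ⟹ δ)
HA-⊥L ⊥∈Γ = by-left ⊥∈Γ (⊥L _ _) []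

HA-cut : ∀ {Γ φ δ} → HA⊢ (Γ ⟹ φ) → HA⊢ ((φ ∷ Γ) ⟹ δ) → HA⊢ (Γ ⟹ δ)
HA-cut p q = by-base (cut _ _ _) (p ∷ q ∷ [])

HA-⇒R : ∀ {Γ φ ψ} → HA⊢ ((φ ∷ Γ) ⟹ ψ) → HA⊢ (Γ ⟹ (φ ⇒ᶠ ψ))
HA-⇒R p = by-base (⇒R _ _ _) (p ∷ [])

HA-⇒L : ∀ {Γ φ ψ δ} → (φ ⇒ᶠ ψ) ∈ Γ → HA⊢ (Γ ⟹ φ) → HA⊢ ((ψ ∷ Γ) ⟹ δ) → HA⊢ (Γ ⟹ δ)
HA-⇒L m p q = by-left m (⇒L _ _ _ _) (p ∷ q ∷ [])

HA-∧L : ∀ {Γ φ ψ δ} → (φ ∧ᶠ ψ) ∈ Γ → HA⊢ ((φ ∷ ψ ∷ Γ) ⟹ δ) → HA⊢ (Γ ⟹ δ)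
HA-∧L m p = by-left m (∧L _ _ _ _) (p ∷ [])

HA-∧R : ∀ {Γ φ ψ} → HA⊢ (Γ ⟹ φ) → HA⊢ (Γ ⟹ ψ) → HA⊢ (Γ ⟹ (φ ∧ᶠ ψ))
HA-∧R p q = by-base (∧R _ _ _) (p ∷ q ∷ [])

HA-∨L : ∀ {Γ φ ψ δ} → (φ ∨ᶠ ψ) ∈ Γ → HA⊢ ((φ ∷ Γ) ⟹ δ) → HA⊢ ((ψ ∷ Γ) ⟹ δ) → HA⊢ (Γ ⟹ δ)
HA-∨L m p q = by-left m (∨L _ _ _ _) (p ∷ q ∷ [])

HA-∀L : ∀ {Γ φ δ} (t : Term 0) → ∀ᶠ φ ∈ Γ → HA⊢ ((inst φ t ∷ Γ) ⟹ δ) → HA⊢ (Γ ⟹ δ)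
HA-∀L t m p = by-left m (∀L _ _ t _) (p ∷ [])

HA-∀R : ∀ {Γ φ} y → y ∉ fvL Γ → y ∉ fvF (∀ᶠ φ) → HA⊢ (Γ ⟹ inst φ (fv y)) → HA⊢ (Γ ⟹ ∀ᶠ φ)
HA-∀R y y∉Γ y∉φ p = by-base (∀R _ _ y y∉Γ y∉φ) (p ∷ [])

-- The induction axiom for F with x abstracted, instantiated at x itself.
HA-ind : ∀ {H} x F → x ∉ fvL H →
  HA⊢ (H ⟹ fsubF (single x zer) F) →
  HA⊢ ((F ∷ H) ⟹ fsubF (single x (succ (fv x))) F) →
  HA⊢ (H ⟹ F)
HA-ind {H} x F x∉H p₀ pₛ =
  subst (λ G → HA⊢ (H ⟹ G)) (inst-closeF-fv x F)
    (HA-cut φ₀ (HA-cut (HA-wk there φₛ) (HA-wk swap (by (ind φ (fv x)) ≈ₛ-refl []))))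
  where
  φ = closeF x F
  φ₀ : HA⊢ (H ⟹ inst φ zer)
  φ₀ = subst (λ G → HA⊢ (H ⟹ G)) (sym (inst-closeF x F zer)) p₀
  x∉step : x ∉ fvF (∀ᶠ (φ ⇒ᶠ stepBody φ))
  x∉step = [ ∉-fvF-closeF x F , ∉-fvF-closeF x F ∘ fvF-stepBody φ ]′ ∘ ∈-++⁻ _
  φₛ : HA⊢ (H ⟹ ∀ᶠ (φ ⇒ᶠ stepBody φ))
  φₛ = HA-∀R x x∉H x∉step (HA-⇒R (subst₂ (λ G G′ → HA⊢ ((G ∷ H) ⟹ G′))
            (sym (inst-closeF-fv x F)) (sym (inst-stepBody-closeF x F (fv x))) pₛ))
  swap : (inst φ zer ∷ ∀ᶠ (φ ⇒ᶠ stepBody φ) ∷ []) ⊆ (∀ᶠ (φ ⇒ᶠ stepBody φ) ∷ inst φ zer ∷ H)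
  swap (here refl)         = there (here refl)
  swap (there (here refl)) = here refl

⋀ : List (Formula 0) → Formula 0
⋀ []      = ⊤ᶠ
⋀ (φ ∷ Γ) = φ ∧ᶠ ⋀ Γ

fsubF-⋀ : ∀ σ Γ → fsubF σ (⋀ Γ) ≡ ⋀ (map (fsubF σ) Γ)
fsubF-⋀ σ []      = refl
fsubF-⋀ σ (φ ∷ Γ) = cong (fsubF σ φ ∧ᶠ_) (fsubF-⋀ σ Γ)

fvF-⋀ : ∀ Γ → fvF (⋀ Γ) ⊆ fvL Γ
fvF-⋀ []      = λ ()
fvF-⋀ (φ ∷ Γ) = ++⁺ ⊆-refl (fvF-⋀ Γ)

HA-⋀R : ∀ {Δ} Γ → (∀ {φ} → φ ∈ Γ → HA⊢ (Δ ⟹ φ)) → HA⊢ (Δ ⟹ ⋀ Γ)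
HA-⋀R []      _ = HA-⇒R (HA-⊥L (here refl))
HA-⋀R (φ ∷ Γ) p = HA-∧R (p (here refl)) (HA-⋀R Γ (p ∘ there))

HA-⋀L : ∀ Γ {Δ δ} → ⋀ Γ ∈ Δ → HA⊢ ((Γ ++ Δ) ⟹ δ) → HA⊢ (Δ ⟹ δ)
HA-⋀L []      _ p = p
HA-⋀L (φ ∷ Γ) m p =
  HA-∧L m (HA-⋀L Γ (there (here refl)) (HA-wk (⊆-trans (∷⁺ʳ φ (++⁺ʳ Γ (xs⊆x∷xs _ _))) (push Γ)) p))

curry-⋀ : ∀ {H Γ δ} → HA⊢ ((H ++ Γ) ⟹ δ) → HA⊢ (H ⟹ (⋀ Γ ⇒ᶠ δ))
curry-⋀ {H} {Γ} p = HA-⇒R (HA-⋀L Γ (here refl) (HA-wk ([ ∈-++⁺ʳ Γ ∘ there , ∈-++⁺ˡ ]′ ∘ ∈-++⁻ H) p))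

uncurry-⋀ : ∀ {H Γ δ} → HA⊢ (H ⟹ (⋀ Γ ⇒ᶠ δ)) → HA⊢ ((H ++ Γ) ⟹ δ)
uncurry-⋀ {H} {Γ} p =
  HA-cut (HA-wk (xs⊆xs++ys H Γ) p)
    (HA-⇒L (here refl) (HA-⋀R Γ (HA-ax ∘ there ∘ ∈-++⁺ʳ H)) (HA-ax (here refl)))

closeAll : List ℕ → Formula 0 → Formula 0
closeAll []       F = F
closeAll (z ∷ zs) F = ∀ᶠ (closeF z (closeAll zs F))

fvF-closeAll : ∀ zs F → fvF (closeAll zs F) ⊆ fvF F
fvF-closeAll []       F = ⊆-refl
fvF-closeAll (z ∷ zs) F = fvF-closeAll zs F ∘ fvF-closeF z (closeAll zs F)

∉-fvF-closeAll : ∀ {z} zs F → z ∈ zs → z ∉ fvF (closeAll zs F)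
∉-fvF-closeAll (z ∷ zs) F (here refl) = ∉-fvF-closeF z (closeAll zs F)
∉-fvF-closeAll (z ∷ zs) F (there m)   = ∉-fvF-closeAll zs F m ∘ fvF-closeF z (closeAll zs F)

HA-closeAllR : ∀ {H} zs {F} → (∀ {z} → z ∈ zs → z ∉ fvL H) → HA⊢ (H ⟹ F) → HA⊢ (H ⟹ closeAll zs F)
HA-closeAllR []       fresh p = p
HA-closeAllR {H} (z ∷ zs) {F} fresh p =
  HA-∀R z (fresh (here refl)) (∉-fvF-closeF z (closeAll zs F))
    (subst (λ G → HA⊢ (H ⟹ G)) (sym (inst-closeF-fv z (closeAll zs F))) (HA-closeAllR zs (fresh ∘ there) p))

HA-closeAllL : ∀ {Δ δ} zs {F} → closeAll zs F ∈ Δ → HA⊢ ((F ∷ Δ) ⟹ δ) → HA⊢ (Δ ⟹ δ)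
HA-closeAllL []       m p = HA-cut (HA-ax m) p
HA-closeAllL {Δ} {δ} (z ∷ zs) {F} m p =
  HA-∀L (fv z) m (subst (λ G → HA⊢ ((G ∷ Δ) ⟹ δ)) (sym (inst-closeF-fv z (closeAll zs F)))
    (HA-closeAllL zs (here refl) (HA-wk (∷⁺ʳ F there) p)))

fsubF-closeAll : ∀ σ zs F → (∀ {z} → z ∈ zs → Fixes σ z) → fsubF σ (closeAll zs F) ≡ closeAll zs (fsubF σ F)
fsubF-closeAll σ []       F fixes = refl
fsubF-closeAll σ (z ∷ zs) F fixes =
  cong ∀ᶠ (trans (fsubF-closeF (fixes (here refl)) (closeAll zs F))
                 (cong (closeF z) (fsubF-closeAll σ zs F (fixes ∘ there))))

infixr 5 _▷_
_▷_ : List (Formula 0) → Sequent → Sequent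
H ▷ (Γ ⟹ δ) = (H ++ Γ) ⟹ δ

▷-resp-≈ : ∀ H {S T} → HA⊢ (H ▷ T) → S ≈ₛ T → HA⊢ (H ▷ S)
▷-resp-≈ H {_ ⟹ _} {_ ⟹ _} p (_ , T⊆S , refl) = HA-wk (++⁺ʳ H T⊆S) p

map-fsubF-++ : ∀ σ H Γ → (∀ y → y ∈ fvL H → σ y ≡ fv y) → map (fsubF σ) (H ++ Γ) ≡ H ++ map (fsubF σ) Γ
map-fsubF-++ σ H Γ fix =
  trans (map-++ (fsubF σ) H Γ)
        (cong (_++ map (fsubF σ) Γ)
              (map-id-local (tabulate {xs = H} λ φ∈H → fsubF-id σ _ (λ y → fix y ∘ fvL-∈ φ∈H))))

double-≢ : ∀ x s y t z → ¬ z ≡ x → ¬ z ≡ y → double x s y t z ≡ fv z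
double-≢ x s y t z z≢x z≢y with z ≟ x
... | yes z≡x = ⊥-elim (z≢x z≡x)
... | no  _ with z ≟ y
...   | yes z≡y = ⊥-elim (z≢y z≡y)
...   | no  _   = refl

∉-fvT-double : ∀ x s y t {w} → w ≡ x ⊎ w ≡ y → w ∉ fvT s ++ fvT t → ∀ z → w ∉ fvT (double x s y t z)
∉-fvT-double x s y t w∈xy w∉st z w∈ with z ≟ x
... | yes _ = w∉st (∈-++⁺ˡ w∈)
... | no z≢x with z ≟ y
...   | yes _ = w∉st (∈-++⁺ʳ (fvT s) w∈)
∉-fvT-double x s y t (inj₁ refl) w∉st z (here refl) | no z≢x | no z≢y = z≢x refl
∉-fvT-double x s y t (inj₂ refl) w∉st z (here refl) | no z≢x | no z≢y = z≢y refl

-- The equated variables x and y do not occur in the conclusion of =L, so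
-- the substitutions of the rule leave an extra context H untouched.
lift-≐L : ∀ H Γ δ x y s t (x≢y : ¬ x ≡ y) (x∉ : x ∉ fvT s ++ fvT t) (y∉ : y ∉ fvT s ++ fvT t) →
  fvL H ⊆ fvSeq (((s ≐ t) ∷ map (fsubF (double x s y t)) Γ) ⟹ fsubF (double x s y t) δ) →
  HA⊢ (H ▷ (map (fsubF (single y (fv x))) Γ ⟹ fsubF (single y (fv x)) δ)) →
  HA⊢ (H ▷ (((s ≐ t) ∷ map (fsubF (double x s y t)) Γ) ⟹ fsubF (double x s y t) δ))
lift-≐L H Γ δ x y s t x≢y x∉ y∉ fvH p =
  HA-wk (push H)
    (subst (λ Δ → HA⊢ (((s ≐ t) ∷ Δ) ⟹ fsubF σ₂ δ))
      (map-fsubF-++ σ₂ H Γ (untouched {σ₂} (double-≢ x s y t)))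
      (by-base (≐L (H ++ Γ) δ x y s t x≢y x∉ y∉)
        (subst (λ Δ → HA⊢ (Δ ⟹ fsubF σ₁ δ))
          (sym (map-fsubF-++ σ₁ H Γ (untouched {σ₁} λ z _ → single-≢ y (fv x) z))) p
         ∷ [])))
  where
  σ₁ = single y (fv x)
  σ₂ = double x s y t
  absent : ∀ {w} → w ≡ x ⊎ w ≡ y → w ∉ fvT s ++ fvT t →
    w ∉ fvSeq (((s ≐ t) ∷ map (fsubF σ₂) Γ) ⟹ fsubF σ₂ δ)
  absent w∈xy w∉st =
    [ [ w∉st , no-origin ∘ fvL-map-fsubF σ₂ Γ ]′ ∘ ∈-++⁻ (fvT s ++ fvT t) , no-origin ∘ fvF-fsubF σ₂ δ ]′
    ∘ ∈-++⁻ _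
    where
    no-origin : ∀ {zs} → ¬ Origin σ₂ zs _
    no-origin o with z , _ , w∈ ← find o = ∉-fvT-double x s y t w∈xy w∉st z w∈
  untouched : ∀ {σ} → (∀ z → ¬ z ≡ x → ¬ z ≡ y → σ z ≡ fv z) → ∀ z → z ∈ fvL H → σ z ≡ fv z
  untouched σ-id z z∈H =
    σ-id z (λ { refl → absent (inj₁ refl) x∉ (fvH z∈H) }) (λ { refl → absent (inj₂ refl) y∉ (fvH z∈H) })

-- The hypothesis on H keeps the eigenvariable conditions of ∀R and ∃L valid.
lift-BaseRule : ∀ H {C Ps} → BaseRule C Ps → fvL H ⊆ fvSeq C → All (λ P → HA⊢ (H ▷ P)) Ps → HA⊢ (H ▷ C)
lift-BaseRule H (ax Γ δ)    _ [] = HA-ax (∈-++⁺ʳ H (here refl))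
lift-BaseRule H (⊥L Γ δ)    _ [] = HA-⊥L (∈-++⁺ʳ H (here refl))
lift-BaseRule H (⇒L Γ φ ψ δ) _ (p ∷ q ∷ []) =
  HA-⇒L (∈-++⁺ʳ H (here refl)) (HA-wk (++⁺ʳ H there) p) (HA-wk (pull H there) q)
lift-BaseRule H (⇒R Γ φ ψ)  _ (p ∷ []) = HA-⇒R (HA-wk (pull H ⊆-refl) p)
lift-BaseRule H (∧L Γ φ ψ δ) _ (p ∷ []) =
  HA-∧L (∈-++⁺ʳ H (here refl)) (HA-wk (⊆-trans (pull H ⊆-refl) (∷⁺ʳ φ (pull H there))) p)
lift-BaseRule H (∧R Γ φ ψ)  _ (p ∷ q ∷ []) = HA-∧R p q
lift-BaseRule H (∨L Γ φ ψ δ) _ (p ∷ q ∷ []) =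
  HA-∨L (∈-++⁺ʳ H (here refl)) (HA-wk (pull H there) p) (HA-wk (pull H there) q)
lift-BaseRule H (∨R₁ Γ φ ψ) _ (p ∷ []) = by-base (∨R₁ (H ++ Γ) φ ψ) (p ∷ [])
lift-BaseRule H (∨R₂ Γ φ ψ) _ (p ∷ []) = by-base (∨R₂ (H ++ Γ) φ ψ) (p ∷ [])
lift-BaseRule H (∀L Γ φ t δ) _ (p ∷ []) = HA-∀L t (∈-++⁺ʳ H (here refl)) (HA-wk (pull H there) p)
lift-BaseRule H (∀R Γ φ y y∉Γ y∉φ) fvH (p ∷ []) = HA-∀R y y∉HΓ y∉φ p
  where
  y∉HΓ : y ∉ fvL (H ++ Γ)
  y∉HΓ = [ [ y∉Γ , y∉φ ]′ ∘ ∈-++⁻ (fvL Γ) ∘ fvH , y∉Γ ]′ ∘ fvL-++⁻ H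
lift-BaseRule H (∃L Γ φ δ y y∉Γ y∉φ y∉δ) fvH (p ∷ []) =
  by-left (∈-++⁺ʳ H (here refl)) (∃L (H ++ ∃ᶠ φ ∷ Γ) φ δ y y∉H∃Γ y∉φ y∉δ) (HA-wk (pull H there) p ∷ [])
  where
  y∉∃Γ : y ∉ fvL (∃ᶠ φ ∷ Γ)
  y∉∃Γ = [ y∉φ , y∉Γ ]′ ∘ ∈-++⁻ (fvF φ)
  y∉H∃Γ : y ∉ fvL (H ++ ∃ᶠ φ ∷ Γ)
  y∉H∃Γ = [ [ y∉∃Γ , y∉δ ]′ ∘ ∈-++⁻ (fvL (∃ᶠ φ ∷ Γ)) ∘ fvH , y∉∃Γ ]′ ∘ fvL-++⁻ H
lift-BaseRule H (∃R Γ φ t)  _ (p ∷ []) = by-base (∃R (H ++ Γ) φ t) (p ∷ [])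
lift-BaseRule H (≐L Γ δ x y s t x≢y x∉ y∉) fvH (p ∷ []) = lift-≐L H Γ δ x y s t x≢y x∉ y∉ fvH p
lift-BaseRule H (≐R Γ t)    _ [] = by-base (≐R (H ++ Γ) t) []
lift-BaseRule H (wk Γ Γ′ δ) _ (p ∷ []) = HA-wk (subst (_ ⊆_) (++-assoc H Γ Γ′) (xs⊆xs++ys _ _)) p
lift-BaseRule H (cut Γ φ δ) _ (p ∷ q ∷ []) = HA-cut p (HA-wk (pull H ⊆-refl) q)
lift-BaseRule H (zeroNeqS t) _ [] = HA-wk (λ ()) (by-base (zeroNeqS t) [])
lift-BaseRule H (sInj s t)  _ [] = HA-wk (λ { (here refl) → ∈-++⁺ʳ H (here refl) }) (by-base (sInj s t) [])
lift-BaseRule H (plus0 s)   _ [] = HA-wk (λ ()) (by-base (plus0 s) [])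
lift-BaseRule H (plusS s t) _ [] = HA-wk (λ ()) (by-base (plusS s t) [])
lift-BaseRule H (times0 s)  _ [] = HA-wk (λ ()) (by-base (times0 s) [])
lift-BaseRule H (timesS s t) _ [] = HA-wk (λ ()) (by-base (timesS s t) [])

-- Case_z becomes induction on z for the formula ⋀ Γ ⇒ δ.
lift-Case : ∀ H z Γ δ → z ∉ fvL H →
  HA⊢ (H ▷ substSeq (single z zer) (Γ ⟹ δ)) →
  HA⊢ (H ▷ substSeq (single z (succ (fv z))) (Γ ⟹ δ)) →
  HA⊢ (H ▷ (Γ ⟹ δ))
lift-Case H z Γ δ z∉H p₀ pₛ = uncurry-⋀ (HA-ind z (⋀ Γ ⇒ᶠ δ) z∉H (curried p₀) (HA-wk there (curried pₛ)))
  where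
  curried : ∀ {σ} → HA⊢ (H ▷ substSeq σ (Γ ⟹ δ)) → HA⊢ (H ⟹ fsubF σ (⋀ Γ ⇒ᶠ δ))
  curried {σ} p rewrite fsubF-⋀ σ Γ = curry-⋀ p

mutual
  subtree-++ : ∀ u p q → subtree u (p ++ q) ≡ (subtree u p >>= λ v → subtree v q)
  subtree-++ u                 []      q = refl
  subtree-++ (bud _ _)         (_ ∷ _) q = refl
  subtree-++ (node _ _ _ _ cs) (j ∷ p) q = subtreeL-++ cs j p q

  subtreeL-++ : ∀ cs j p q → subtreeL cs j (p ++ q) ≡ (subtreeL cs j p >>= λ v → subtree v q)
  subtreeL-++ []       j       p q = refl
  subtreeL-++ (c ∷ cs) zero    p q = subtree-++ c p q
  subtreeL-++ (c ∷ cs) (suc j) p q = subtreeL-++ cs j p q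

mutual
  paths : PTree → List Path
  paths (bud _ _)         = [ [] ]
  paths (node _ _ _ _ cs) = [] ∷ pathsFrom 0 cs

  pathsFrom : ℕ → List PTree → List Path
  pathsFrom j []       = []
  pathsFrom j (c ∷ cs) = map (j ∷_) (paths c) ++ pathsFrom (suc j) cs

mutual
  paths-complete : ∀ u p {v} → subtree u p ≡ just v → p ∈ paths u
  paths-complete (bud _ _)         []      _ = here refl
  paths-complete (node _ _ _ _ cs) []      _ = here refl
  paths-complete (node _ _ _ _ cs) (k ∷ p) e =
    there (subst (λ i → i ∷ p ∈ pathsFrom 0 cs) (+-identityʳ k) (pathsFrom-complete cs 0 k p e))

  pathsFrom-complete : ∀ cs j k p {v} → subtreeL cs k p ≡ just v → (k + j) ∷ p ∈ pathsFrom j cs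
  pathsFrom-complete (c ∷ cs) j zero    p e = ∈-++⁺ˡ (∈-map⁺ (j ∷_) (paths-complete c p e))
  pathsFrom-complete (c ∷ cs) j (suc k) p e =
    ∈-++⁺ʳ (map (j ∷_) (paths c))
      (subst (λ i → i ∷ p ∈ pathsFrom (suc j) cs) (+-suc k j) (pathsFrom-complete cs (suc j) k p e))

-- The graph of a pre-proof: its vertices are the (non-bud) nodes, and the
-- successors of a node are its children, with a bud replaced by its companion.

module PreProofGraph (t : PTree) (nodes-ok : NodesOK t) (buds-ok : BudsOK t) where

  -- junk label for paths off the tree
  labelAt : Path → Sequent
  labelAt p = maybe′ label ([] ⟹ ⊥ᶠ) (subtree t p)

  record NodeAt (p : Path) : Set where
    constructor node-at
    field
      S C      : Sequent
      Ps       : List Sequent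
      rule     : CHARule C Ps
      children : List PTree
      at       : subtree t p ≡ just (node S C Ps rule children)

  nodeAt? : ∀ p → Dec (NodeAt p)
  nodeAt? p with subtree t p in eq
  ... | just (node S C Ps r cs) = yes (node-at S C Ps r cs eq)
  ... | just (bud _ _) = no λ n → case trans (sym eq) (NodeAt.at n) of λ ()
  ... | nothing        = no λ n → case trans (sym eq) (NodeAt.at n) of λ ()

  AllNodes : List Path → Set
  AllNodes S = ∀ {p} → p ∈ S → NodeAt p

  CaseAt : ℕ → Path → Set
  CaseAt x p = CaseM x (subtree t p)

  CaseAt? : ∀ x p → Dec (CaseAt x p)
  CaseAt? x p with subtree t p
  ... | nothing                            = no λ ()
  ... | just (bud _ _)                     = no λ ()
  ... | just (node _ _ _ (base _) _)       = no λ ()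
  ... | just (node _ _ _ (case y _ _) _)   = x ≟ y

  free-labelAt : ∀ {x} p → FreeInM x (subtree t p) → x ∈ fvSeq (labelAt p)
  free-labelAt p x∈ with subtree t p
  ... | just _ = x∈

  successorsFrom : Path → ℕ → List PTree → List Path
  successorsFrom p j []                      = []
  successorsFrom p j (bud _ q ∷ cs)          = q ∷ successorsFrom p (suc j) cs
  successorsFrom p j (node _ _ _ _ _ ∷ cs)   = (p ++ [ j ]) ∷ successorsFrom p (suc j) cs

  successorsOf : Path → Maybe PTree → List Path
  successorsOf p (just (node _ _ _ _ cs)) = successorsFrom p 0 cs
  successorsOf p _                        = []

  successors : Path → List Path
  successors p = successorsOf p (subtree t p)

  successors-node : ∀ {p} (n : NodeAt p) → successors p ≡ successorsFrom p 0 (NodeAt.children n)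
  successors-node (node-at _ _ _ _ _ at) rewrite at = refl

  labelAt-node : ∀ {p} (n : NodeAt p) → labelAt p ≡ NodeAt.S n
  labelAt-node (node-at _ _ _ _ _ at) rewrite at = refl

  node-conclusion : ∀ {p} (n : NodeAt p) → labelAt p ≈ₛ NodeAt.C n
  node-conclusion {p} n@(node-at S C Ps r cs at) rewrite labelAt-node n = proj₁ (nodes-ok p S C Ps r cs at)

  ChildrenFrom : Path → ℕ → List PTree → Set
  ChildrenFrom p j cs = ∀ k → subtree t (p ++ [ k + j ]) ≡ subtreeL cs k []

  children-node : ∀ {p} (n : NodeAt p) → ChildrenFrom p 0 (NodeAt.children n)
  children-node {p} (node-at _ _ _ _ _ at) k rewrite subtree-++ t p [ k + 0 ] | at | +-identityʳ k = refl

  children-next : ∀ p j {c cs} → ChildrenFrom p j (c ∷ cs) → ChildrenFrom p (suc j) cs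
  children-next p j h k = trans (cong (λ i → subtree t (p ++ [ i ])) (+-suc k j)) (h (suc k))

  data Edge (p q : Path) : Set where
    to-child     : ∀ j → q ≡ p ++ [ j ] → NodeAt q → Edge p q
    to-companion : ∀ j S → subtree t (p ++ [ j ]) ≡ just (bud S q) → Edge p q

  edgeFrom : ∀ {p q} j cs → ChildrenFrom p j cs → q ∈ successorsFrom p j cs → Edge p q
  edgeFrom j (bud S q ∷ cs)            h (here refl) = to-companion j S (h 0)
  edgeFrom j (node S C Ps r cs′ ∷ cs)  h (here refl) = to-child j refl (node-at S C Ps r cs′ (h 0))
  edgeFrom {p} j (bud _ _ ∷ cs)        h (there m)   = edgeFrom (suc j) cs (children-next p j h) m
  edgeFrom {p} j (node _ _ _ _ _ ∷ cs) h (there m)   = edgeFrom (suc j) cs (children-next p j h) m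

  edge : ∀ p {q} → q ∈ successors p → Edge p q
  edge p {q} q∈ with nodeAt? p
  ... | yes n = edgeFrom 0 (NodeAt.children n) (children-node n) (subst (q ∈_) (successors-node n) q∈)
  ... | no ¬n = ⊥-elim (no-successor q∈)
    where
    no-successor : q ∉ successors p
    no-successor _ with subtree t p in eq
    no-successor () | nothing
    no-successor () | just (bud _ _)
    ... | just (node S C Ps r cs) = ¬n (node-at S C Ps r cs eq)

  companion : ∀ {p S q} → subtree t p ≡ just (bud S q) → NodeAt q
  companion {p} {S} {q} at with buds-ok p S q at
  ... | S₂ , C , Ps , r , c , cs , at′ , _ = node-at S₂ C Ps r (c ∷ cs) at′

  edge-target : ∀ {p q} → Edge p q → NodeAt q
  edge-target (to-child _ _ n)          = n
  edge-target {p} (to-companion j _ at) = companion {p ++ [ j ]} at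

  successor-node : ∀ p {q} → q ∈ successors p → NodeAt q
  successor-node p = edge-target ∘ edge p

  Premise : Path → Sequent → Set
  Premise p P = ∃ λ q → q ∈ successors p × P ≈ₛ labelAt q

  premisesFrom : ∀ {p} j cs Ps → ChildrenFrom p j cs → Pointwise (λ c P → label c ≈ₛ P) cs Ps →
    All (λ P → ∃ λ q → q ∈ successorsFrom p j cs × P ≈ₛ labelAt q) Ps
  premisesFrom j [] [] h [] = []
  premisesFrom {p} j (bud S q ∷ cs) (P ∷ Ps) h (c≈P ∷ cs≈Ps) with buds-ok (p ++ [ j ]) S q (h 0)
  ... | _ , _ , _ , _ , _ , _ , at , S≈S₂ =
    (q , here refl , ≈ₛ-trans (≈ₛ-sym c≈P) (subst (S ≈ₛ_) (cong (maybe′ label _) (sym at)) S≈S₂))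
    ∷ All.map (λ (q′ , m , P≈) → q′ , there m , P≈) (premisesFrom (suc j) cs Ps (children-next p j h) cs≈Ps)
  premisesFrom {p} j (node _ _ _ _ _ ∷ cs) (P ∷ Ps) h (c≈P ∷ cs≈Ps) =
    (p ++ [ j ] , here refl , subst (P ≈ₛ_) (cong (maybe′ label _) (sym (h 0))) (≈ₛ-sym c≈P))
    ∷ All.map (λ (q′ , m , P≈) → q′ , there m , P≈) (premisesFrom (suc j) cs Ps (children-next p j h) cs≈Ps)

  premises : ∀ {p} (n : NodeAt p) → All (Premise p) (NodeAt.Ps n)
  premises {p} n@(node-at S C Ps r cs at) =
    All.map (λ (q , m , P≈) → q , subst (q ∈_) (sym (successors-node n)) m , P≈)
      (premisesFrom 0 cs Ps (children-node n) (proj₂ (nodes-ok p S C Ps r cs at)))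

  premises-proved : ∀ H {p} (n : NodeAt p) → (∀ {q} → q ∈ successors p → HA⊢ (H ▷ labelAt q)) →
    All (λ P → HA⊢ (H ▷ P)) (NodeAt.Ps n)
  premises-proved H n proved = All.map (λ (_ , q∈ , P≈) → ▷-resp-≈ H (proved q∈) P≈) (premises n)

  record CaseNode (x : ℕ) (c : Path) : Set where
    field
      Γ            : List (Formula 0)
      δ            : Formula 0
      label≈       : labelAt c ≈ₛ (Γ ⟹ δ)
      zero-premise : Premise c (substSeq (single x zer) (Γ ⟹ δ))
      succ-premise : Premise c (substSeq (single x (succ (fv x))) (Γ ⟹ δ))

  case-node : ∀ {x c} → NodeAt c → CaseAt x c → CaseNode x c
  case-node (node-at _ _ _ (base _) _ at) case-c = ⊥-elim (subst (CaseM _) at case-c)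
  case-node {x} n@(node-at _ _ _ (case y Γ δ) _ at) case-c with refl ← subst (CaseM x) at case-c
                                                           with p₀ ∷ pₛ ∷ [] ← premises n =
    record { Γ = Γ ; δ = δ ; label≈ = node-conclusion n ; zero-premise = p₀ ; succ-premise = pₛ }

  Proved : List (Formula 0) → Path → Set
  Proved H p = HA⊢ (H ▷ labelAt p)

  prove-node : ∀ H {p} → NodeAt p → fvL H ⊆ fvSeq (labelAt p) → (∀ {y} → y ∈ fvL H → ¬ CaseAt y p) →
    (∀ {q} → q ∈ successors p → Proved H q) → Proved H p
  prove-node H n@(node-at _ _ _ (base r) _ _) fvH _ proved =
    ▷-resp-≈ H (lift-BaseRule H r (fvSeq-≈ (node-conclusion n) ∘ fvH) (premises-proved H n proved))
      (node-conclusion n)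
  prove-node H n@(node-at _ _ _ (case z Γ δ) _ at) _ no-case proved with premises-proved H n proved
  ... | p₀ ∷ pₛ ∷ [] = ▷-resp-≈ H (lift-Case H z Γ δ z∉H p₀ pₛ) (node-conclusion n)
    where
    z∉H : z ∉ fvL H
    z∉H z∈H = no-case z∈H (subst (CaseM z) (sym at) refl)

  _≟ₚ_ : DecidableEquality Path
  _≟ₚ_ = ≡-dec _≟_

  open import Data.List.Membership.DecPropositional _≟ₚ_ using (_∈?_)

  -- Paths from p to q with intermediate vertices in K; the recursion on K, as
  -- in the Floyd–Warshall algorithm, makes reachability decidable.
  Reach : List Path → Path → Path → Set
  Reach []      p q = q ∈ successors p
  Reach (s ∷ K) p q = Reach K p q ⊎ (Reach K p s × Reach K s q)

  reach? : ∀ K p q → Dec (Reach K p q)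
  reach? []      p q = q ∈? successors p
  reach? (s ∷ K) p q = reach? K p q ⊎-dec (reach? K p s ×-dec reach? K s q)

  reach-edge : ∀ K {p q} → q ∈ successors p → Reach K p q
  reach-edge []      e = e
  reach-edge (s ∷ K) e = inj₁ (reach-edge K e)

  reach-trans : ∀ K {p m q} → m ∈ K → Reach K p m → Reach K m q → Reach K p q
  reach-trans (s ∷ K) (here refl) p⇝s s⇝q = inj₂ ([ id , proj₁ ]′ p⇝s , [ id , proj₂ ]′ s⇝q)
  reach-trans (s ∷ K) (there m) (inj₁ a)       (inj₁ b)       = inj₁ (reach-trans K m a b)
  reach-trans (s ∷ K) (there m) (inj₁ a)       (inj₂ (b , c)) = inj₂ (reach-trans K m a b , c)
  reach-trans (s ∷ K) (there m) (inj₂ (a , b)) (inj₁ c)       = inj₂ (a , reach-trans K m b c)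
  reach-trans (s ∷ K) (there m) (inj₂ (a , _)) (inj₂ (_ , c)) = inj₂ (a , c)

  data Walk (K : List Path) : Path → Path → Set where
    last : ∀ {p q}   → q ∈ successors p → Walk K p q
    via  : ∀ {p q r} → q ∈ successors p → q ∈ K → Walk K q r → Walk K p r

  append-walk : ∀ {K p s q} → Walk K p s → s ∈ K → Walk K s q → Walk K p q
  append-walk (last e)      s∈K w′ = via e s∈K w′
  append-walk (via e q∈K w) s∈K w′ = via e q∈K (append-walk w s∈K w′)

  walk-mono : ∀ {K K′ p q} → K ⊆ K′ → Walk K p q → Walk K′ p q
  walk-mono K⊆K′ (last e)      = last e
  walk-mono K⊆K′ (via e q∈K w) = via e (K⊆K′ q∈K) (walk-mono K⊆K′ w)

  reach⇒walk : ∀ K {p q} → Reach K p q → Walk K p q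
  reach⇒walk []      e              = last e
  reach⇒walk (s ∷ K) (inj₁ a)       = walk-mono there (reach⇒walk K a)
  reach⇒walk (s ∷ K) (inj₂ (a , b)) =
    append-walk (walk-mono there (reach⇒walk K a)) (here refl) (walk-mono there (reach⇒walk K b))

  vertices : ∀ {K p q} → Walk K p q → List Path
  vertices (last {q = q} _)    = [ q ]
  vertices (via {q = q} _ _ w) = q ∷ vertices w

  end∈vertices : ∀ {K p q} (w : Walk K p q) → q ∈ vertices w
  end∈vertices (last _)    = here refl
  end∈vertices (via _ _ w) = there (end∈vertices w)

  vertices-inner : ∀ {K p q} (w : Walk K p q) {v} → v ∈ vertices w → v ∈ K ⊎ v ≡ q
  vertices-inner (last _)        (here refl) = inj₂ refl
  vertices-inner (via _ q∈K _)   (here refl) = inj₁ q∈K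
  vertices-inner (via _ _ w)     (there m)   = vertices-inner w m

  vertices-appendˡ : ∀ {K p s q} (w : Walk K p s) (s∈K : s ∈ K) (w′ : Walk K s q) →
    vertices w ⊆ vertices (append-walk w s∈K w′)
  vertices-appendˡ (last _)    s∈K w′ (here refl) = here refl
  vertices-appendˡ (via _ _ w) s∈K w′ (here refl) = here refl
  vertices-appendˡ (via _ _ w) s∈K w′ (there m)   = there (vertices-appendˡ w s∈K w′ m)

  vertices-appendʳ : ∀ {K p s q} (w : Walk K p s) (s∈K : s ∈ K) (w′ : Walk K s q) →
    vertices w′ ⊆ vertices (append-walk w s∈K w′)
  vertices-appendʳ (last _)    s∈K w′ = there
  vertices-appendʳ (via _ _ w) s∈K w′ = there ∘ vertices-appendʳ w s∈K w′

  StronglyConnected : List Path → Set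
  StronglyConnected S = ∀ {a b} → a ∈ S → b ∈ S → Reach S a b

  covering-cycle : ∀ {S p₀} → p₀ ∈ S → StronglyConnected S → ∀ L → L ⊆ S →
    Σ (Walk S p₀ p₀) λ w → L ⊆ vertices w
  covering-cycle p₀∈S sc []      _   = reach⇒walk _ (sc p₀∈S p₀∈S) , λ ()
  covering-cycle {S} p₀∈S sc (s ∷ L) L⊆S with w , L⊆w ← covering-cycle p₀∈S sc L (L⊆S ∘ there) =
    append-walk loop p₀∈S w ,
    λ { (here refl) → vertices-appendˡ loop p₀∈S w (vertices-appendˡ out s∈S back (end∈vertices out))
      ; (there m)   → vertices-appendʳ loop p₀∈S w (L⊆w m) }
    where
    s∈S  = L⊆S (here refl)
    out  = reach⇒walk S (sc p₀∈S s∈S)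
    back = reach⇒walk S (sc s∈S p₀∈S)
    loop = append-walk out s∈S back

  data Chain : Path → List Path → Set where
    []  : ∀ {p} → Chain p []
    _∷_ : ∀ {p q L} → Next t p q → Chain q L → Chain p (q ∷ L)

  endpoint : Path → List Path → Path
  endpoint p []      = p
  endpoint p (q ∷ L) = endpoint q L

  chain-++ : ∀ {p L L′} → Chain p L → Chain (endpoint p L) L′ → Chain p (L ++ L′)
  chain-++ []      ch′ = ch′
  chain-++ (n ∷ ch) ch′ = n ∷ chain-++ ch ch′

  endpoint-++ : ∀ p L L′ → endpoint p (L ++ L′) ≡ endpoint (endpoint p L) L′
  endpoint-++ p []      L′ = refl
  endpoint-++ p (q ∷ L) L′ = endpoint-++ q L L′

  is-just : ∀ {m : Maybe PTree} {u} → m ≡ just u → Is-just m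
  is-just refl = just tt

  IsBud : Path → Set
  IsBud e = ∃₂ λ S q → subtree t e ≡ just (bud S q)

  edge-steps : ∀ p {q} → Edge p q → List Path
  edge-steps p {q} (to-child _ _ _)     = [ q ]
  edge-steps p {q} (to-companion j _ _) = (p ++ [ j ]) ∷ [ q ]

  edge-chain : ∀ p {q} (E : Edge p q) → Chain p (edge-steps p E) × endpoint p (edge-steps p E) ≡ q
  edge-chain p (to-child j refl n)  = (inj₁ (j , refl , is-just (NodeAt.at n)) ∷ []) , refl
  edge-chain p (to-companion j S at) = (inj₁ (j , refl , is-just at) ∷ inj₂ (S , at) ∷ []) , refl

  edge-steps-∈ : ∀ p {q} (E : Edge p q) {e} → e ∈ edge-steps p E → e ≡ q ⊎ IsBud e
  edge-steps-∈ p (to-child _ _ _)      (here refl)         = inj₁ refl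
  edge-steps-∈ p (to-companion _ S at) (here refl)         = inj₂ (S , _ , at)
  edge-steps-∈ p (to-companion _ _ _)  (there (here refl)) = inj₁ refl

  end∈edge-steps : ∀ p {q} (E : Edge p q) → q ∈ edge-steps p E
  end∈edge-steps p (to-child _ _ _)     = here refl
  end∈edge-steps p (to-companion _ _ _) = there (here refl)

  walk-steps : ∀ {K p q} → Walk K p q → List Path
  walk-steps {p = p} (last e)    = edge-steps p (edge p e)
  walk-steps {p = p} (via e _ w) = edge-steps p (edge p e) ++ walk-steps w

  walk-chain : ∀ {K p q} (w : Walk K p q) → Chain p (walk-steps w) × endpoint p (walk-steps w) ≡ q
  walk-chain {p = p} (last e) = edge-chain p (edge p e)
  walk-chain {p = p} (via e _ w) with ch , end ← edge-chain p (edge p e) | ch′ , end′ ← walk-chain w =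
    chain-++ ch (subst (λ r → Chain r (walk-steps w)) (sym end) ch′) ,
    trans (endpoint-++ p (edge-steps p (edge p e)) (walk-steps w))
          (trans (cong (λ r → endpoint r (walk-steps w)) end) end′)

  walk-steps-∈ : ∀ {K p q} (w : Walk K p q) {e} → e ∈ walk-steps w → e ∈ vertices w ⊎ IsBud e
  walk-steps-∈ {p = p} (last e) m =
    [ (λ { refl → inj₁ (here refl) }) , inj₂ ]′ (edge-steps-∈ p (edge p e) m)
  walk-steps-∈ {p = p} (via e _ w) m with ∈-++⁻ (edge-steps p (edge p e)) m
  ... | inj₁ m′ = [ (λ { refl → inj₁ (here refl) }) , inj₂ ]′ (edge-steps-∈ p (edge p e) m′)
  ... | inj₂ m′ = [ inj₁ ∘ there , inj₂ ]′ (walk-steps-∈ w m′)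

  vertices⊆walk-steps : ∀ {K p q} (w : Walk K p q) → vertices w ⊆ walk-steps w
  vertices⊆walk-steps {p = p} (last e)    (here refl) = end∈edge-steps p (edge p e)
  vertices⊆walk-steps {p = p} (via e _ w) (here refl) = ∈-++⁺ˡ (end∈edge-steps p (edge p e))
  vertices⊆walk-steps {p = p} (via e _ w) (there m)   = ∈-++⁺ʳ _ (vertices⊆walk-steps w m)

  is-just-prefix : ∀ p q → Is-just (subtree t (p ++ q)) → Is-just (subtree t p)
  is-just-prefix p q ij rewrite subtree-++ t p q with subtree t p
  ... | just _ = just tt

  descend : Path → List ℕ → List Path
  descend p []      = []
  descend p (j ∷ js) = (p ++ [ j ]) ∷ descend (p ++ [ j ]) js

  descend-chain : ∀ p js → Is-just (subtree t (p ++ js)) →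
    Chain p (descend p js) × endpoint p (descend p js) ≡ p ++ js
  descend-chain p []       _  = [] , sym (++-identityʳ p)
  descend-chain p (j ∷ js) ij with ij′ ← subst (Is-just ∘ subtree t) (sym (++-assoc p [ j ] js)) ij
                            with ch , end ← descend-chain (p ++ [ j ]) js ij′ =
    inj₁ (j , refl , is-just-prefix (p ++ [ j ]) js ij′) ∷ ch , trans end (++-assoc p [ j ] js)

  -- unroll cur L runs through cur ∷ L and then around c ∷ cs forever.
  module Cycle (c : Path) (cs : List Path) where

    unroll : Path → List Path → ℕ → Path
    unroll cur L       zero    = cur
    unroll cur []      (suc n) = unroll c cs n
    unroll cur (x ∷ L) (suc n) = unroll x L n

    unroll-next : ∀ {p₀} → Chain p₀ (c ∷ cs) → endpoint p₀ (c ∷ cs) ≡ p₀ →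
      ∀ n cur L → Chain cur L → endpoint cur L ≡ p₀ → Next t (unroll cur L n) (unroll cur L (suc n))
    unroll-next cyc end zero    cur (x ∷ L) (nx ∷ _)  _    = nx
    unroll-next (nx ∷ _) end zero cur [] _ refl          = nx
    unroll-next cyc end (suc n) cur (x ∷ L) (_ ∷ ch) end′ = unroll-next cyc end n x L ch end′
    unroll-next cyc@(_ ∷ ch) end (suc n) cur [] _ _      = unroll-next cyc end n c cs ch end

    unroll-∈ : ∀ i cur L → cur ∈ c ∷ cs → L ⊆ c ∷ cs → unroll cur L i ∈ c ∷ cs
    unroll-∈ zero    cur L       cur∈ _   = cur∈
    unroll-∈ (suc i) cur []      _    _   = unroll-∈ i c cs (here refl) there
    unroll-∈ (suc i) cur (x ∷ L) _    L⊆  = unroll-∈ i x L (L⊆ (here refl)) (L⊆ ∘ there)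

    unroll-late : ∀ i cur L → length L < i → unroll cur L i ∈ c ∷ cs
    unroll-late (suc i) cur []      _         = unroll-∈ i c cs (here refl) there
    unroll-late (suc i) cur (x ∷ L) (s≤s L<i) = unroll-late i x L L<i

    unroll-skip : ∀ cur L k → unroll cur L (length L + suc k) ≡ unroll c cs k
    unroll-skip cur []      k = refl
    unroll-skip cur (x ∷ L) k = unroll-skip x L k

    unroll-hit : ∀ cur L {e} → e ∈ cur ∷ L → ∃ λ j → unroll cur L j ≡ e
    unroll-hit cur L       (here refl) = 0 , refl
    unroll-hit cur (x ∷ L) (there m) with j , eq ← unroll-hit x L m = suc j , eq

    after-laps : ℕ → ℕ → ℕ
    after-laps zero    j = j
    after-laps (suc M) j = length cs + suc (after-laps M j)

    unroll-laps : ∀ M j → unroll c cs (after-laps M j) ≡ unroll c cs j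
    unroll-laps zero    j = refl
    unroll-laps (suc M) j = trans (unroll-skip c cs (after-laps M j)) (unroll-laps M j)

    laps-≥ : ∀ M j → M ≤ after-laps M j
    laps-≥ zero    j = z≤n
    laps-≥ (suc M) j = ≤-trans (s≤s (laps-≥ M j)) (m≤n+m _ (length cs))

    unroll-recurrent : ∀ M {e} → e ∈ c ∷ cs → ∀ cur L → ∃ λ i → M ≤ i × unroll cur L i ≡ e
    unroll-recurrent M e∈ cur L with j , eq ← unroll-hit c cs e∈ =
      length L + suc (after-laps M j) ,
      ≤-trans (laps-≥ M j) (≤-trans (n≤1+n _) (m≤n+m _ (length L))) ,
      trans (unroll-skip cur L (after-laps M j)) (trans (unroll-laps M j) eq)

module Translation (t : PTree) (nodes-ok : NodesOK t) (buds-ok : BudsOK t)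
  (traces : ∀ b → InfiniteBranch t b → Σ ℕ λ x → ProgressingTrace t b x) where

  open PreProofGraph t nodes-ok buds-ok

  -- A closed chain through a node is the periodic part of an infinite branch,
  -- so it carries a progressing trace.
  module _ {p₀} c cs (n₀ : NodeAt p₀) (ch : Chain p₀ (c ∷ cs)) (end : endpoint p₀ (c ∷ cs) ≡ p₀) where
    open Cycle c cs

    private
      prefix : List Path
      prefix = descend [] p₀

      branch : ℕ → Path
      branch = unroll [] prefix

      infinite : InfiniteBranch t branch
      infinite with ch₀ , end₀ ← descend-chain [] p₀ (is-just (NodeAt.at n₀)) =
        refl , λ i → unroll-next ch end i [] prefix ch₀ end₀

    cycle-progress : ∃ λ x → (∀ {e} → e ∈ c ∷ cs → x ∈ fvSeq (labelAt e)) × ∃ λ e → e ∈ c ∷ cs × CaseAt x e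
    cycle-progress with x , (N , free) , cases ← traces branch infinite = x , free-on-cycle , case-on-cycle
      where
      free-on-cycle : ∀ {e} → e ∈ c ∷ cs → x ∈ fvSeq (labelAt e)
      free-on-cycle e∈ with i , N≤i , refl ← unroll-recurrent N e∈ [] prefix = free-labelAt (branch i) (free i N≤i)
      case-on-cycle : ∃ λ e → e ∈ c ∷ cs × CaseAt x e
      case-on-cycle with i , i> , case-i ← cases (suc (length prefix)) =
        branch i , unroll-late i [] prefix i> , case-i

  ProgressesOn : ℕ → List Path → Set
  ProgressesOn x S = (∀ {s} → s ∈ S → x ∈ fvSeq (labelAt s)) × ∃ λ e → e ∈ S × CaseAt x e

  strongly-connected-progress : ∀ {S p₀} → p₀ ∈ S → AllNodes S → StronglyConnected S →
    ∃ λ x → ProgressesOn x S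
  strongly-connected-progress {S} {p₀} p₀∈S nodes sc
    with w , S⊆w ← covering-cycle p₀∈S sc S ⊆-refl
    with c , cs , steps≡ ← ∈⇒nonempty (vertices⊆walk-steps w (end∈vertices w))
    with ch , end ← walk-chain w
    with x , free , e , e∈ , case-e ← cycle-progress c cs (nodes p₀∈S)
           (subst (Chain p₀) steps≡ ch) (subst (λ L → endpoint p₀ L ≡ p₀) steps≡ end) =
    x , free ∘ on-cycle , e , e∈S , case-e
    where
    on-cycle : S ⊆ c ∷ cs
    on-cycle = subst (_ ∈_) steps≡ ∘ vertices⊆walk-steps w ∘ S⊆w
    e∈S : e ∈ S
    e∈S with walk-steps-∈ w (subst (e ∈_) (sym steps≡) e∈)
    ... | inj₂ (_ , _ , at) = ⊥-elim (subst (CaseM x) at case-e)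
    ... | inj₁ v            = [ id , (λ { refl → p₀∈S }) ]′ (vertices-inner w v)

  record Region (H : List (Formula 0)) (S : List Path) : Set where
    field
      nodes   : AllNodes S
      fv-ctx  : ∀ {y p} → y ∈ fvL H → p ∈ S → y ∈ fvSeq (labelAt p)
      no-case : ∀ {y p} → y ∈ fvL H → p ∈ S → ¬ CaseAt y p
      closed  : ∀ {p q} → p ∈ S → q ∈ successors p → q ∈ S ⊎ Proved H q
  open Region

  Solvable : ℕ → Set
  Solvable n = ∀ H S → length S ≤ n → Region H S → ∀ {p} → p ∈ S → Proved H p

  restrict : ∀ {H S} {P : Path → Set} (P? : Decidable P) → Region H S →
    (∀ {p q} → p ∈ S → P p → q ∈ successors p → q ∈ S → ¬ P q → Proved H q) →
    Region H (filter P? S)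
  restrict {S = S} P? R leave .nodes        = nodes R ∘ proj₁ ∘ ∈-filter⁻ P? {xs = S}
  restrict {S = S} P? R leave .fv-ctx y∈H   = fv-ctx R y∈H ∘ proj₁ ∘ ∈-filter⁻ P? {xs = S}
  restrict {S = S} P? R leave .no-case y∈H  = no-case R y∈H ∘ proj₁ ∘ ∈-filter⁻ P? {xs = S}
  restrict {S = S} P? R leave .closed {q = q} p∈ e
    with p∈S , Pp ← ∈-filter⁻ P? {xs = S} p∈ with closed R p∈S e
  ... | inj₂ proved = inj₂ proved
  ... | inj₁ q∈S with P? q
  ...   | yes Pq = inj₁ (∈-filter⁺ P? q∈S Pq)
  ...   | no ¬Pq = inj₂ (leave p∈S Pp e q∈S ¬Pq)

  shorter : ∀ {n S a} {P : Path → Set} (P? : Decidable P) → a ∈ S → ¬ P a → length S ≤ suc n →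
    length (filter P? S) ≤ n
  shorter {S = S} P? a∈S ¬Pa |S|≤ = ≤-pred (<-≤-trans (filter-notAll P? S (lose a∈S ¬Pa)) |S|≤)

  -- a reaches nothing in S: a is proved from outside S, and then the rest.
  prove-sink : ∀ {n H S a} → Solvable n → length S ≤ suc n → Region H S → a ∈ S →
    (∀ {q} → q ∈ S → ¬ Reach S a q) → ∀ {p} → p ∈ S → Proved H p
  prove-sink {n} {H} {S} {a} ih |S|≤ R a∈S sink {p} p∈S = case p ≟ₚ a of λ where
      (yes refl) → proved-a
      (no p≢a)   → ih H (filter ≢a? S) (shorter ≢a? a∈S (λ a≢a → a≢a refl) |S|≤)
                      (restrict ≢a? R λ _ _ _ _ ¬q≢a →
                         subst (Proved H) (sym (decidable-stable (_ ≟ₚ a) ¬q≢a)) proved-a)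
                      (∈-filter⁺ ≢a? p∈S p≢a)
    where
    ≢a? : Decidable (λ q → ¬ q ≡ a)
    ≢a? q = ¬? (q ≟ₚ a)
    proved-a : Proved H a
    proved-a = prove-node H (nodes R a∈S) (λ y∈H → fv-ctx R y∈H a∈S) (λ y∈H → no-case R y∈H a∈S)
      λ e → [ (λ q∈S → ⊥-elim (sink q∈S (reach-edge S e))) , id ]′ (closed R a∈S e)

  -- a reaches some but not all of S: first the part reachable from a, then the rest.
  prove-split : ∀ {n H S a b q} → Solvable n → length S ≤ suc n → Region H S →
    b ∈ S → ¬ Reach S a b → q ∈ S → Reach S a q → ∀ {p} → p ∈ S → Proved H p
  prove-split {n} {H} {S} {a} ih |S|≤ R b∈S ¬a⇝b q∈S a⇝q {p} p∈S = case reach? S a p of λ where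
      (yes a⇝p) → proved-reachable (∈-filter⁺ (reach? S a) p∈S a⇝p)
      (no ¬a⇝p) → ih H (filter unreachable? S) (shorter unreachable? q∈S (λ ¬a⇝q → ¬a⇝q a⇝q) |S|≤)
                     (restrict unreachable? R λ _ _ _ r∈S ¬¬a⇝r →
                        proved-reachable
                          (∈-filter⁺ (reach? S a) r∈S (decidable-stable (reach? S a _) ¬¬a⇝r)))
                     (∈-filter⁺ unreachable? p∈S ¬a⇝p)
    where
    unreachable? : Decidable (λ r → ¬ Reach S a r)
    unreachable? = ¬? ∘ reach? S a
    proved-reachable : ∀ {r} → r ∈ filter (reach? S a) S → Proved H r
    proved-reachable = ih H (filter (reach? S a) S) (shorter (reach? S a) b∈S ¬a⇝b |S|≤)
      (restrict (reach? S a) R λ r∈S a⇝r e _ ¬a⇝r′ →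
         ⊥-elim (¬a⇝r′ (reach-trans S r∈S a⇝r (reach-edge S e))))

  module StronglyConnectedRegion {n H S x} (ih : Solvable n) (|S|≤ : length S ≤ suc n) (R : Region H S)
    (x-free : ∀ {s} → s ∈ S → x ∈ fvSeq (labelAt s)) {e} (e∈S : e ∈ S) (case-e : CaseAt x e) where

    σ₀ σₛ : ℕ → Term 0
    σ₀ = single x zer
    σₛ = single x (succ (fv x))

    x∉H : x ∉ fvL H
    x∉H x∈H = no-case R x∈H e∈S case-e

    Cs : List Path
    Cs = filter (CaseAt? x) S

    generalised? : Decidable (λ z → ¬ z ≡ x × z ∉ fvL H)
    generalised? z = ¬? (z ≟ x) ×-dec ¬? (z ∈ℕ? fvL H)

    zs : Path → List ℕ
    zs c = filter generalised? (fvSeq (labelAt c))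

    zs-generalised : ∀ c {z} → z ∈ zs c → ¬ z ≡ x × z ∉ fvL H
    zs-generalised c = proj₂ ∘ ∈-filter⁻ generalised? {xs = fvSeq (labelAt c)}

    Φ : Path → Formula 0
    Φ c = closeAll (zs c) (⋀ (ante (labelAt c)) ⇒ᶠ cons (labelAt c))

    ψ : Formula 0
    ψ = ⋀ (map Φ Cs)

    H′ : List (Formula 0)
    H′ = H ++ [ ψ ]

    fvF-Φ : ∀ c → fvF (Φ c) ⊆ x ∷ fvL H
    fvF-Φ c {y} y∈Φ with y ≟ x | y ∈ℕ? fvL H
    ... | yes refl | _       = here refl
    ... | no _     | yes y∈H = there y∈H
    ... | no y≢x   | no y∉H  =
      ⊥-elim (∉-fvF-closeAll (zs c) _ (∈-filter⁺ generalised? y∈c (y≢x , y∉H)) y∈Φ)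
      where
      y∈c : y ∈ fvSeq (labelAt c)
      y∈c = ++⁺ (fvF-⋀ (ante (labelAt c))) ⊆-refl (fvF-closeAll (zs c) _ y∈Φ)

    fvF-ψ : fvF ψ ⊆ x ∷ fvL H
    fvF-ψ y∈ψ with φ , φ∈ , y∈φ ← fvL-∈⁻ (map Φ Cs) (fvF-⋀ (map Φ Cs) y∈ψ)
              with c , _ , refl ← ∈-map⁻ Φ φ∈ = fvF-Φ c y∈φ

    fvL-H′ : fvL H′ ⊆ x ∷ fvL H
    fvL-H′ y∈ = [ there , [ fvF-ψ , (λ ()) ]′ ∘ ∈-++⁻ (fvF ψ) ]′ (fvL-++⁻ H y∈)

    ψ-first : ∀ Γ → H′ ++ Γ ⊆ ψ ∷ H ++ Γ
    ψ-first Γ = pull H ⊆-refl ∘ subst (_ ∈_) (++-assoc H [ ψ ] Γ)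

    weaken-H′ : ∀ {q} → Proved H q → Proved H′ q
    weaken-H′ = HA-wk (++⁺ˡ _ (xs⊆xs++ys H [ ψ ]))

    case-axiom : ∀ {c} → c ∈ S → CaseAt x c → Proved H′ c
    case-axiom {c} c∈S case-c =
      uncurry-⋀ (HA-⋀L (map Φ Cs) (∈-++⁺ʳ H (here refl))
        (HA-closeAllL (zs c) (∈-++⁺ˡ (∈-map⁺ Φ (∈-filter⁺ (CaseAt? x) c∈S case-c))) (HA-ax (here refl))))

    non-case? : Decidable (λ q → ¬ CaseAt x q)
    non-case? = ¬? ∘ CaseAt? x

    region′ : Region H′ (filter non-case? S)
    region′ .nodes = nodes R ∘ proj₁ ∘ ∈-filter⁻ non-case? {xs = S}
    region′ .fv-ctx y∈H′ q∈ with q∈S , _ ← ∈-filter⁻ non-case? {xs = S} q∈ with fvL-H′ y∈H′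
    ... | here refl = x-free q∈S
    ... | there y∈H = fv-ctx R y∈H q∈S
    region′ .no-case y∈H′ q∈ with q∈S , ¬case ← ∈-filter⁻ non-case? {xs = S} q∈ with fvL-H′ y∈H′
    ... | here refl = ¬case
    ... | there y∈H = no-case R y∈H q∈S
    region′ .closed {q = q} p∈ e with closed R (proj₁ (∈-filter⁻ non-case? {xs = S} p∈)) e
    ... | inj₂ proved = inj₂ (weaken-H′ {q} proved)
    ... | inj₁ q∈S with CaseAt? x q
    ...   | yes case-q = inj₂ (case-axiom q∈S case-q)
    ...   | no ¬case-q = inj₁ (∈-filter⁺ non-case? q∈S ¬case-q)

    proved-under-ψ : ∀ {q} → q ∈ S → Proved H′ q
    proved-under-ψ {q} q∈S with CaseAt? x q
    ... | yes case-q = case-axiom q∈S case-q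
    ... | no ¬case-q =
      ih H′ (filter non-case? S) (shorter non-case? e∈S (λ ¬case → ¬case case-e) |S|≤) region′
        (∈-filter⁺ non-case? q∈S ¬case-q)

    close-instance : ∀ {K σ} c → (∀ {z} → z ∈ zs c → Fixes σ z) → (∀ {z} → z ∈ zs c → z ∉ fvL K) →
      HA⊢ (K ▷ substSeq σ (labelAt c)) → HA⊢ (K ⟹ fsubF σ (Φ c))
    close-instance {K} {σ} c fixes fresh p
      rewrite fsubF-closeAll σ (zs c) (⋀ (ante (labelAt c)) ⇒ᶠ cons (labelAt c)) fixes
            | fsubF-⋀ σ (ante (labelAt c)) = HA-closeAllR (zs c) fresh (curry-⋀ p)

    ψ-instance : ∀ {K σ} → (∀ {c} → c ∈ Cs → HA⊢ (K ⟹ fsubF σ (Φ c))) → HA⊢ (K ⟹ fsubF σ ψ)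
    ψ-instance {K} {σ} each rewrite fsubF-⋀ σ (map Φ Cs) = HA-⋀R _ conjunct
      where
      conjunct : ∀ {φ} → φ ∈ map (fsubF σ) (map Φ Cs) → HA⊢ (K ⟹ φ)
      conjunct m with _ , m′ , refl ← ∈-map⁻ (fsubF σ) m with _ , c∈ , refl ← ∈-map⁻ Φ m′ = each c∈

    -- The zero premise of a Case_x node lies outside S, as x is not free in it.
    Φ-zero : ∀ {c} → c ∈ Cs → HA⊢ (H ⟹ fsubF σ₀ (Φ c))
    Φ-zero {c} c∈Cs with c∈S , case-c ← ∈-filter⁻ (CaseAt? x) {xs = S} c∈Cs
      with record { Γ = Γ ; δ = δ ; label≈ = label≈ ; zero-premise = q , q∈ , P≈ }
             ← case-node (nodes R c∈S) case-c =
      close-instance c (λ z∈ → single-Fixes x zer _ (proj₁ (zs-generalised c z∈)) λ ())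
        (proj₂ ∘ zs-generalised c)
        (▷-resp-≈ H (▷-resp-≈ H {T = labelAt q} proved-q P≈) (substSeq-≈ σ₀ label≈))
      where
      proved-q : Proved H q
      proved-q = [ (λ q∈S → ⊥-elim (∉-fvSeq-single-zer x (Γ ⟹ δ) (fvSeq-≈ (≈ₛ-sym P≈) (x-free q∈S))))
                 , id ]′ (closed R c∈S q∈)

    Φ-succ : ∀ {c} → c ∈ Cs → HA⊢ ((ψ ∷ H) ⟹ fsubF σₛ (Φ c))
    Φ-succ {c} c∈Cs with c∈S , case-c ← ∈-filter⁻ (CaseAt? x) {xs = S} c∈Cs
      with record { Γ = Γ ; δ = δ ; label≈ = label≈ ; succ-premise = q , q∈ , P≈ }
             ← case-node (nodes R c∈S) case-c =
      close-instance c
        (λ z∈ → single-Fixes x (succ (fv x)) _ (proj₁ (zs-generalised c z∈)) (∉x∷H z∈ ∘ here ∘ head-≡))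
        (λ z∈ → [ ∉x∷H z∈ ∘ fvF-ψ , ∉x∷H z∈ ∘ there ]′ ∘ ∈-++⁻ (fvF ψ))
        (HA-wk (ψ-first _) (▷-resp-≈ H′ (▷-resp-≈ H′ {T = labelAt q} proved-q P≈) (substSeq-≈ σₛ label≈)))
      where
      proved-q : Proved H′ q
      proved-q = [ proved-under-ψ , weaken-H′ {q} ]′ (closed R c∈S q∈)
      ∉x∷H : ∀ {z} → z ∈ zs c → z ∉ x ∷ fvL H
      ∉x∷H z∈ (here refl) = proj₁ (zs-generalised c z∈) refl
      ∉x∷H z∈ (there z∈H) = proj₂ (zs-generalised c z∈) z∈H
      head-≡ : ∀ {z} → z ∈ [ x ] → z ≡ x
      head-≡ (here z≡x) = z≡x

    ψ-proved : HA⊢ (H ⟹ ψ)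
    ψ-proved = HA-ind x ψ x∉H (ψ-instance Φ-zero) (ψ-instance Φ-succ)

    prove : ∀ {p} → p ∈ S → Proved H p
    prove p∈S = HA-cut (HA-wk (xs⊆xs++ys H _) ψ-proved) (HA-wk (ψ-first _) (proved-under-ψ p∈S))

  data Shape (S : List Path) : Set where
    strongly-connected : StronglyConnected S → Shape S
    sink  : ∀ {a} → a ∈ S → (∀ {q} → q ∈ S → ¬ Reach S a q) → Shape S
    split : ∀ {a b q} → b ∈ S → ¬ Reach S a b → q ∈ S → Reach S a q → Shape S

  shape : ∀ S → Shape S
  shape S with all? (λ a → all? (reach? S a) S) S
  ... | yes sc = strongly-connected λ a∈S → All.lookup (All.lookup sc a∈S)
  ... | no ¬sc
    with a , a∈S , ¬a⇝S ← find (¬All⇒Any¬ (λ a → all? (reach? S a) S) S ¬sc)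
    with b , b∈S , ¬a⇝b ← find (¬All⇒Any¬ (reach? S a) S ¬a⇝S)
    with any? (reach? S a) S
  ...   | no ¬a⇝  = sink a∈S λ q∈S a⇝q → ¬a⇝ (lose q∈S a⇝q)
  ...   | yes a⇝ with q , q∈S , a⇝q ← find a⇝ = split b∈S ¬a⇝b q∈S a⇝q

  prove-region : ∀ n → Solvable n
  prove-region zero    H []      _ _ ()
  prove-region zero    H (_ ∷ _) () _ _
  prove-region (suc n) H S |S|≤ R p∈S with shape S
  ... | strongly-connected sc
    with x , x-free , e , e∈S , case-e ← strongly-connected-progress p∈S (nodes R) sc =
    StronglyConnectedRegion.prove (prove-region n) |S|≤ R x-free e∈S case-e p∈S
  ... | sink a∈S none           = prove-sink (prove-region n) |S|≤ R a∈S none p∈S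
  ... | split b∈S ¬a⇝b q∈S a⇝q = prove-split (prove-region n) |S|≤ R b∈S ¬a⇝b q∈S a⇝q p∈S

  -- A bud at the root could have no companion.
  root-node : NodeAt []
  root-node = node-of t refl
    where
    node-of : ∀ u → t ≡ u → NodeAt []
    node-of (node S C Ps r cs) eq = node-at S C Ps r cs (cong just eq)
    node-of (bud S q) eq with _ , _ , _ , _ , _ , _ , at , _ ← buds-ok [] S q (cong just eq) =
      ⊥-elim (no-node q (trans (cong (λ u → subtree u q) (sym eq)) at))
      where
      no-node : ∀ q {S′ C Ps r cs} → ¬ subtree (bud S q) q ≡ just (node S′ C Ps r cs)
      no-node []      ()
      no-node (_ ∷ _) ()

  root-proved : HA⊢ ([] ▷ label t)
  root-proved =
    prove-region (length V) [] V ≤-refl region (∈-filter⁺ nodeAt? (paths-complete t [] refl) root-node)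
    where
    V : List Path
    V = filter nodeAt? (paths t)
    region : Region [] V
    region .nodes        = proj₂ ∘ ∈-filter⁻ nodeAt? {xs = paths t}
    region .fv-ctx ()
    region .no-case ()
    region .closed {p} _ e = inj₁ (∈-filter⁺ nodeAt? (paths-complete t _ (NodeAt.at n)) n)
      where n = successor-node p e

theorem6p1 : (Γ : List (Formula 0)) (δ : Formula 0) → CHA⊢ (Γ ⟹ δ) → HA⊢ (Γ ⟹ δ)
theorem6p1 Γ δ (t , ((nodes-ok , buds-ok) , traces) , root≈) =
  ▷-resp-≈ [] (Translation.root-proved t nodes-ok buds-ok traces) (≈ₛ-sym root≈)
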